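{- Let $G$ be a finite simple graph on $[d]$ and $K$ a field. Let $R_G$ be the polynomial ring over $K$ in the variables $z$, $x_{i+},x_{i- }$ ($1\le i\le d$), and $y_{ij++},y_{ij-- },y_{ij+- },y_{ij-+}$ ($\{i,j\}\in E(G)$), where $y_{ij\alpha\beta}$ is identified with $y_{ji\beta\alpha}$. Let $\pi:R_G\to K[t_1^{\pm1},\ldots,t_d^{\pm1},s]$ be given by $\pi(z)=s$, $\pi(x_{i\alpha})=t_i^{\alpha1}s$, $\pi(y_{ij\alpha\beta})=t_i^{\alpha1}t_j^{\beta1}s$, and let $I_{\mathcal{B}_G}=\ker\pi$. Let $S_G\subset R_G$ be the polynomial subring in the variables $z$, $x_{i+}$ ($1\le i\le d$), $y_{ij++}$ ($\{i,j\}\in E(G)$), and $I_{P_{\widetilde G}}=\ker(\pi|_{S_G})$. For $\varepsilon\in\{ -1,1\}^d$ let $\varphi_\varepsilon:S_G\to R_G$ be the $K$-algebra homomorphism with $\varphi_\varepsilon(z)=z$, $\varphi_\varepsilon(x_{i+})=x_{i\alpha}$, $\varphi_\varepsilon(y_{ij++})=y_{ij\alpha\beta}$, where $\alpha,\beta$ are the signs of $\varepsilon_i,\varepsilon_j$. Let $\mathcal{G}$ be a Gröbner basis of $I_{P_{\widetilde G}}$ with respect to a reverse lexicographic order $<_S$ on $S_G$ such that $z<x_{i+}<y_{jk++}$ for all $i$ and all $\{j,k\}\in E(G)$. Let $<_R$ be a reverse lexicographic order on $R_G$ such that $z$ is smaller than every $x$-variable, every $x$-variable is smaller than every $y$-variable,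 and for all $\varepsilon\in\{ -1,1\}^d$: (i) $\varphi_\varepsilon(x_{i+})<_R\varphi_\varepsilon(x_{j+})$ whenever $x_{i+}<_S x_{j+}$, and (ii) $\varphi_\varepsilon(y_{ij++})<_R\varphi_\varepsilon(y_{k\ell++})$ whenever $y_{ij++}<_S y_{k\ell++}$. Then $$\mathcal{G}'=\Big(\bigcup_{\varepsilon\in\{ -1,1\}^d}\varphi_\varepsilon(\mathcal{G})\Big)\cup\{x_{i\alpha}y_{ij\beta\gamma}-x_{j\gamma}z:\{i,j\}\in E(G),\alpha\ne\beta\}\cup\{y_{ij\alpha\gamma}y_{ik\beta\delta}-x_{j\gamma}x_{k\delta}:\{i,j\},\{i,k\}\in E(G),\alpha\ne\beta\}\cup\{x_{i+}x_{i- }-z^2:1\le i\le d\}$$ is a Gröbner basis of $I_{\mathcal{B}_G}$ with respect to $<_R$, where in each of the last three families the initial monomial is the first monomial ($x_{i\alpha}y_{ij\beta\gamma}$, $y_{ij\alpha\gamma}y_{ik\beta\delta}$, $x_{i+}x_{i- }$ respectively). In particular, if $\mathrm{in}_{<_S}(I_{P_{\widetilde G}})$ is squarefree (resp. quadratic), then so is $\mathrm{in}_{<_R}(I_{\mathcal{B}_G})$.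
   Context: Signs $\alpha,\beta,\gamma,\delta$ range over $\{+,-\}$, and $t_i^{+1}=t_i$, $t_i^{ -1}$ its inverse. $\ker(\pi|_{S_G})$ is the toric ideal of the edge polytope of the graph $\widetilde{G}$ on $[d+1]$ with edge set $E(G)\cup\{\{i,d+1\}:1\le i\le d\}\cup\{\{d+1,d+1\}\}$; $\ker\pi$ is the toric ideal of $\mathcal{B}_G=\mathrm{conv}(\{\mathbf{0},\pm\mathbf{e}_i\}\cup\{\pm\mathbf{e}_i\pm\mathbf{e}_j:\{i,j\}\in E(G)\})$. An initial ideal is squarefree (resp. quadratic) if generated by squarefree (resp. quadratic) monomials. -}

module Defs where

open import Level using (Level; _⊔_) renaming (suc to lsuc)
open import Data.Bool using (Bool; true; false; T; _∧_; if_then_else_)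
open import Data.Nat using (ℕ; zero; suc; _<_; _≤_; _≡ᵇ_)
open import Data.Nat.Properties using (<-irrelevant)
open import Data.Integer as ℤ using (ℤ; 0ℤ; 1ℤ; -1ℤ)
open import Data.Fin as Fin using (Fin; toℕ)
import Data.Fin.Properties as FinP
open import Data.List using (List; []; _∷_; _++_; length; map; foldr)
open import Data.List.Membership.Propositional using (_∈_)
open import Data.Product using (Σ; Σ-syntax; _×_; _,_; ∃)
open import Data.Sum using (_⊎_)
open import Data.Unit using (tt)
open import Data.Empty using (⊥; ⊥-elim)
open import Relation.Nullary using (¬_; Dec; yes; no)
open import Relation.Nullary.Decidable using (⌊_⌋)
open import Relation.Binary using (tri<; tri≈; tri>)
open import Relation.Binary.Definitions using (DecidableEquality)
open import Relation.Binary.PropositionalEquality using (_≡_; _≢_; refl; subst; sym)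
open import Algebra.Bundles using (CommutativeRing)

record Field (c ℓ : Level) : Set (lsuc (c ⊔ ℓ)) where
  field
    commutativeRing : CommutativeRing c ℓ
  open CommutativeRing commutativeRing public
  field
    1≉0 : ¬ (1# ≈ 0#)
    inverse : ∀ x → ¬ (x ≈ 0#) → ∃ λ y → (x * y) ≈ 1#

record Graph (d : ℕ) : Set where
  field
    adj : Fin d → Fin d → Bool
    adj-sym : ∀ i j → adj i j ≡ adj j i
    adj-irrefl : ∀ i → adj i i ≡ false
open Graph public

data Sgn : Set where
  ⊕ ⊖ : Sgn

_≟s_ : DecidableEquality Sgn
⊕ ≟s ⊕ = yes refl
⊕ ≟s ⊖ = no λ ()
⊖ ≟s ⊕ = no λ ()
⊖ ≟s ⊖ = yes refl

T-irr : (b : Bool) (p q : T b) → p ≡ q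
T-irr true _ _ = refl

allFin : {n : ℕ} → (Fin n → Bool) → Bool
allFin {zero} P = true
allFin {suc n} P = P Fin.zero ∧ allFin (λ i → P (Fin.suc i))

-- A monomial is a finite multiset of variables (a list; order irrelevant),
-- a polynomial is a formal K-linear combination of monomials (a list of
-- terms, not necessarily normalised; all notions below only look at the
-- coefficient function `coeff`).

module PolyTheory {c ℓ : Level} (K : Field c ℓ) {V : Set} (_≟V_ : DecidableEquality V) where
  open Field K

  Mon : Set
  Mon = List V

  exp : Mon → V → ℕ
  exp [] v = 0
  exp (u ∷ m) v = if ⌊ u ≟V v ⌋ then suc (exp m v) else exp m v

  deg : Mon → ℕ
  deg = length

  _≈ₘ_ : Mon → Mon → Set
  m ≈ₘ m' = ∀ v → exp m v ≡ exp m' v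

  -- boolean test for it (only variables occurring in m or m' matter)
  _==ₘ_ : Mon → Mon → Bool
  m ==ₘ m' = foldr (λ v b → (exp m v ≡ᵇ exp m' v) ∧ b) true (m ++ m')

  _∣ₘ_ : Mon → Mon → Set
  m ∣ₘ m' = ∀ v → exp m v ≤ exp m' v

  Poly : Set c
  Poly = List (Carrier × Mon)

  sumWhere : (Mon → Bool) → Poly → Carrier
  sumWhere P [] = 0#
  sumWhere P ((a , m) ∷ f) = if P m then a + sumWhere P f else sumWhere P f

  coeff : Poly → Mon → Carrier
  coeff f m = sumWhere (λ m' → m' ==ₘ m) f

  binom : Mon → Mon → Poly
  binom m₁ m₂ = (1# , m₁) ∷ (- 1# , m₂) ∷ []

  revlex : (V → ℕ) → Mon → Mon → Set
  revlex rank m m' =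
    (deg m < deg m') ⊎
    (deg m ≡ deg m' × Σ[ v ∈ V ] (exp m' v < exp m v × (∀ u → rank u < rank v → exp m u ≡ exp m' u)))

  InjectiveRank : (V → ℕ) → Set
  InjectiveRank rank = ∀ u v → rank u ≡ rank v → u ≡ v

  IsLeading : (Mon → Mon → Set) → Poly → Mon → Set ℓ
  IsLeading _<_ f m = ¬ (coeff f m ≈ 0#) × (∀ m' → ¬ (coeff f m' ≈ 0#) → (m' ≈ₘ m) ⊎ (m' < m))

  IsGroebner : ∀ {p q} → (Mon → Mon → Set) → (Poly → Set p) → (Poly → Set q) → Set (c ⊔ ℓ ⊔ p ⊔ q)
  IsGroebner _<_ I 𝒢 =
    (∀ g → 𝒢 g → I g) ×
    (∀ f m → I f → IsLeading _<_ f m →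
      Σ[ g ∈ Poly ] Σ[ m' ∈ Mon ] (𝒢 g × IsLeading _<_ g m' × (m' ∣ₘ m)))

  InInitial : ∀ {p} → (Mon → Mon → Set) → (Poly → Set p) → Mon → Set (c ⊔ ℓ ⊔ p)
  InInitial _<_ I m = Σ[ f ∈ Poly ] Σ[ m' ∈ Mon ] (I f × IsLeading _<_ f m' × (m' ∣ₘ m))

  InitialGeneratedBy : ∀ {p} → (Mon → Set) → (Mon → Mon → Set) → (Poly → Set p) → Set (lsuc Level.zero ⊔ c ⊔ ℓ ⊔ p)
  InitialGeneratedBy P _<_ I =
    Σ[ S ∈ (Mon → Set) ]
      ((∀ s → S s → P s × InInitial _<_ I s) ×
       (∀ m → InInitial _<_ I m → Σ[ s ∈ Mon ] (S s × (s ∣ₘ m))))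

  Squarefree : Mon → Set
  Squarefree m = ∀ v → exp m v ≤ 1

  Quadratic : Mon → Set
  Quadratic m = deg m ≡ 2

  mapPoly : ∀ {W : Set} → (V → W) → Poly → List (Carrier × List W)
  mapPoly f = map (λ { (a , m) → a , map f m })

  -- Kernel of the monomial map π sending a variable v to t^{wt v} s into
  -- K[t₁^{±1},…,t_d^{±1},s]: π(f) = Σ_{(a,m)} a t^{tvec m} s^{deg m}
  -- vanishes iff the coefficient of every Laurent monomial t^u s^k vanishes.
  module Toric {d : ℕ} (wt : V → Fin d → ℤ) where
    tvec : Mon → Fin d → ℤ
    tvec [] i = 0ℤ
    tvec (v ∷ m) i = wt v i ℤ.+ tvec m i

    InKer : Poly → Set ℓ
    InKer f = ∀ (u : Fin d → ℤ) (k : ℕ) →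
      sumWhere (λ m → allFin (λ i → ⌊ tvec m i ℤ.≟ u i ⌋) ∧ (deg m ≡ᵇ k)) f ≈ 0#

module _ {d : ℕ} (G : Graph d) where

  -- R_G: z, x_{iα}, y_{ijαβ} for {i,j} ∈ E(G); y_{ijαβ} = y_{jiβα} is
  -- realised by only allowing i < j.
  data RVar : Set where
    z : RVar
    x : Fin d → Sgn → RVar
    y : (i j : Fin d) → i Fin.< j → T (adj G i j) → Sgn → Sgn → RVar

  data SVar : Set where
    zS : SVar
    xS : Fin d → SVar
    yS : (i j : Fin d) → i Fin.< j → T (adj G i j) → SVar

module _ {d : ℕ} {G : Graph d} where

  _≟R_ : DecidableEquality (RVar G)
  z ≟R z = yes refl
  z ≟R x _ _ = no λ ()
  z ≟R y _ _ _ _ _ _ = no λ ()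
  x _ _ ≟R z = no λ ()
  x _ _ ≟R y _ _ _ _ _ _ = no λ ()
  y _ _ _ _ _ _ ≟R z = no λ ()
  y _ _ _ _ _ _ ≟R x _ _ = no λ ()
  x i α ≟R x j β with i FinP.≟ j | α ≟s β
  ... | yes refl | yes refl = yes refl
  ... | no ne | _ = no λ { refl → ne refl }
  ... | yes _ | no ne = no λ { refl → ne refl }
  y i j p e α β ≟R y i' j' p' e' α' β' with i FinP.≟ i' | j FinP.≟ j' | α ≟s α' | β ≟s β'
  ... | yes refl | yes refl | yes refl | yes refl with <-irrelevant p p' | T-irr (adj G i j) e e'
  ...   | refl | refl = yes refl
  y i j p e α β ≟R y i' j' p' e' α' β' | no ne | _ | _ | _ = no λ { refl → ne refl }
  y i j p e α β ≟R y i' j' p' e' α' β' | yes _ | no ne | _ | _ = no λ { refl → ne refl }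
  y i j p e α β ≟R y i' j' p' e' α' β' | yes _ | yes _ | no ne | _ = no λ { refl → ne refl }
  y i j p e α β ≟R y i' j' p' e' α' β' | yes _ | yes _ | yes _ | no ne = no λ { refl → ne refl }

  _≟S_ : DecidableEquality (SVar G)
  zS ≟S zS = yes refl
  zS ≟S xS _ = no λ ()
  zS ≟S yS _ _ _ _ = no λ ()
  xS _ ≟S zS = no λ ()
  xS _ ≟S yS _ _ _ _ = no λ ()
  yS _ _ _ _ ≟S zS = no λ ()
  yS _ _ _ _ ≟S xS _ = no λ ()
  xS i ≟S xS j with i FinP.≟ j
  ... | yes refl = yes refl
  ... | no ne = no λ { refl → ne refl }
  yS i j p e ≟S yS i' j' p' e' with i FinP.≟ i' | j FinP.≟ j'
  ... | yes refl | yes refl with <-irrelevant p p' | T-irr (adj G i j) e e'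
  ...   | refl | refl = yes refl
  yS i j p e ≟S yS i' j' p' e' | no ne | _ = no λ { refl → ne refl }
  yS i j p e ≟S yS i' j' p' e' | yes _ | no ne = no λ { refl → ne refl }

  -- y_{ijαβ} for an arbitrary edge {i,j} (either orientation)
  yv : (i j : Fin d) → T (adj G i j) → Sgn → Sgn → RVar G
  yv i j e α β with FinP.<-cmp i j
  ... | tri< p _ _ = y i j p e α β
  ... | tri≈ _ refl _ = ⊥-elim (subst T (adj-irrefl G i) e)
  ... | tri> _ _ p = y j i p (subst T (adj-sym G i j) e) β α

  φ : (Fin d → Sgn) → SVar G → RVar G
  φ ε zS = z
  φ ε (xS i) = x i (ε i)
  φ ε (yS i j p e) = y i j p e (ε i) (ε j)

  ι : SVar G → RVar G
  ι = φ (λ _ → ⊕)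

  -- t-exponents of π on variables: π(z) = s, π(x_{iα}) = t_i^{α1} s,
  -- π(y_{ijαβ}) = t_i^{α1} t_j^{β1} s
  sgnℤ : Sgn → ℤ
  sgnℤ ⊕ = 1ℤ
  sgnℤ ⊖ = -1ℤ

  unitv : Fin d → Sgn → Fin d → ℤ
  unitv i α k = if ⌊ k FinP.≟ i ⌋ then sgnℤ α else 0ℤ

  wtR : RVar G → Fin d → ℤ
  wtR z k = 0ℤ
  wtR (x i α) k = unitv i α k
  wtR (y i j _ _ α β) k = unitv i α k ℤ.+ unitv j β k

module PR {c ℓ : Level} (K : Field c ℓ) {d : ℕ} (G : Graph d) = PolyTheory K (_≟R_ {G = G})
module PS {c ℓ : Level} (K : Field c ℓ) {d : ℕ} (G : Graph d) = PolyTheory K (_≟S_ {G = G})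

module _ {c ℓ : Level} (K : Field c ℓ) {d : ℕ} (G : Graph d) where
  open Field K using (Carrier)

  I-B : PR.Poly K G → Set ℓ
  I-B = PR.Toric.InKer K G wtR

  I-P : PS.Poly K G → Set ℓ
  I-P f = I-B (PS.mapPoly K G ι f)

  G′ : List (PS.Poly K G) → PR.Poly K G → Set c
  G′ 𝒢 g =
    (Σ[ ε ∈ (Fin d → Sgn) ] Σ[ h ∈ PS.Poly K G ] (h ∈ 𝒢 × g ≡ PS.mapPoly K G (φ ε) h))
    ⊎ (Σ[ i ∈ Fin d ] Σ[ j ∈ Fin d ] Σ[ e ∈ T (adj G i j) ] Σ[ α ∈ Sgn ] Σ[ β ∈ Sgn ] Σ[ γ ∈ Sgn ]
         (α ≢ β × g ≡ PR.binom K G (x i α ∷ yv i j e β γ ∷ []) (x j γ ∷ z ∷ [])))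
    ⊎ (Σ[ i ∈ Fin d ] Σ[ j ∈ Fin d ] Σ[ k ∈ Fin d ] Σ[ eij ∈ T (adj G i j) ] Σ[ eik ∈ T (adj G i k) ]
         Σ[ α ∈ Sgn ] Σ[ β ∈ Sgn ] Σ[ γ ∈ Sgn ] Σ[ δ ∈ Sgn ]
         (α ≢ β × g ≡ PR.binom K G (yv i j eij α γ ∷ yv i k eik β δ ∷ []) (x j γ ∷ x k δ ∷ [])))
    ⊎ (Σ[ i ∈ Fin d ] (g ≡ PR.binom K G (x i ⊕ ∷ x i ⊖ ∷ []) (z ∷ z ∷ [])))

module _ {d : ℕ} (G : Graph d) where

  GoodRankS : (SVar G → ℕ) → Set
  GoodRankS rS =
    (∀ u v → rS u ≡ rS v → u ≡ v) ×
    (∀ i → rS zS < rS (xS i)) ×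
    (∀ i j k p e → rS (xS i) < rS (yS j k p e))

  GoodRankR : (SVar G → ℕ) → (RVar G → ℕ) → Set
  GoodRankR rS rR =
    (∀ u v → rR u ≡ rR v → u ≡ v) ×
    (∀ i α → rR z < rR (x i α)) ×
    (∀ i α j k p e β γ → rR (x i α) < rR (y j k p e β γ)) ×
    (∀ (ε : Fin d → Sgn) i j → rS (xS i) < rS (xS j) → rR (φ ε (xS i)) < rR (φ ε (xS j))) ×
    (∀ (ε : Fin d → Sgn) i j p e k l q e' →
       rS (yS i j p e) < rS (yS k l q e') → rR (φ ε (yS i j p e)) < rR (φ ε (yS k l q e')))

module Submission where

-- Write ι = φ_{(+,…,+)} and call a monomial of R_G δ-consistent if it is a
-- φ_δ-image.  The last three families of 𝒢′ are "rules" l → t whose lead l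
-- is a product of two variables carrying some index with opposite signs;
-- hence every monomial either is divisible by the lead of a rule or is
-- consistent.  Let f ∈ I_{B_G} have leading monomial m, not divisible by a
-- rule lead.  Since π(f) = 0, f has another term w ≺ m with π(w) = π(m);
-- rewriting w with the rules (which keep π, go down in the order and lower
-- a weight) gives a consistent n ≺ m with π(n) = π(m).  Because the signs
-- of π(m) determine the signs of all indices occurring in m and n, both
-- are φ_ε-images for the same ε, and their preimages form a binomial of
-- I_{P_G̃} with leading monomial the preimage of m; this preimage is
-- divisible by the leading monomial of some h ∈ 𝒢, so m is divisible by
-- the leading monomial of φ_ε(h) ∈ 𝒢′.

open import Level using (Level; 0ℓ)
open import Function using (_∘_; case_of_; Equivalence; _⇔_; mk⇔)
open import Algebra.Bundles using (CommutativeMonoid)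
open import Data.Bool using (Bool; true; false; T; _∧_; not; if_then_else_)
import Data.Bool.Properties as BoolP
open import Data.Nat as ℕ using (ℕ; zero; suc; _<_; _≤_; _≡ᵇ_; z≤n; s≤s)
import Data.Nat.Properties as ℕP
open import Data.Integer as ℤ using (ℤ; 0ℤ)
import Data.Integer.Properties as ℤP
open import Data.Integer.Tactic.RingSolver using (solve-∀)
open import Data.Fin as Fin using (Fin)
import Data.Fin.Properties as FinP
open import Data.Maybe using (Maybe; just; nothing)
open import Data.Maybe.Properties using (just-injective)
open import Data.List using (List; []; _∷_; _++_; length; map; foldr)
import Data.List.Properties as ListP
open import Data.List.Membership.Propositional using (_∈_; find; lose)
open import Data.List.Membership.Propositional.Properties using (∈-∃++; ∈-++⁺ˡ; ∈-++⁺ʳ)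
open import Data.List.Relation.Unary.Any using (here; there; any?)
open import Data.List.Relation.Unary.All as All using (All; []; _∷_)
open import Data.List.Relation.Binary.Permutation.Propositional as Perm using (_↭_; prep; swap)
open import Data.List.Relation.Binary.Permutation.Propositional.Properties using (shift; ↭-length)
open import Data.Product using (Σ-syntax; _×_; _,_; proj₁; proj₂)
open import Data.Sum using (_⊎_; inj₁; inj₂)
open import Data.Empty using (⊥; ⊥-elim)
open import Data.Unit using (⊤; tt)
open import Relation.Nullary using (¬_; Dec; yes; no)
open import Relation.Nullary.Decidable using (⌊_⌋; _×-dec_; T?; toWitness; fromWitness; isYes≗does; does-⇔)
open import Relation.Binary.Definitions using (DecidableEquality; tri<; tri≈; tri>)
open import Relation.Binary.PropositionalEquality as ≡
  using (_≡_; _≢_; refl; sym; trans; cong; cong₂; subst; subst₂)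

open import Defs

allFin-cong : ∀ {n} (P Q : Fin n → Bool) → (∀ i → P i ≡ Q i) → allFin P ≡ allFin Q
allFin-cong {zero} P Q e = refl
allFin-cong {suc n} P Q e = cong₂ _∧_ (e Fin.zero) (allFin-cong (P ∘ Fin.suc) (Q ∘ Fin.suc) (e ∘ Fin.suc))

allFin-sound : ∀ {n} (P : Fin n → Bool) → T (allFin P) → ∀ i → T (P i)
allFin-sound {suc n} P t Fin.zero = BoolP.T-∧ .Equivalence.to t .proj₁
allFin-sound {suc n} P t (Fin.suc i) = allFin-sound (P ∘ Fin.suc) (BoolP.T-∧ .Equivalence.to t .proj₂) i

allFin-complete : ∀ {n} (P : Fin n → Bool) → (∀ i → T (P i)) → T (allFin P)
allFin-complete {zero} P h = tt
allFin-complete {suc n} P h = BoolP.T-∧ .Equivalence.from (h Fin.zero , allFin-complete (P ∘ Fin.suc) (h ∘ Fin.suc))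

module Monomials {c ℓ : Level} (K : Field c ℓ) {V : Set} (_≟V_ : DecidableEquality V) where
  open PolyTheory K _≟V_

  exp-here : ∀ v m → exp (v ∷ m) v ≡ suc (exp m v)
  exp-here v m with v ≟V v
  ... | yes _ = refl
  ... | no v≢v = ⊥-elim (v≢v refl)

  exp-there : ∀ {u v} m → u ≢ v → exp (u ∷ m) v ≡ exp m v
  exp-there {u} {v} m u≢v with u ≟V v
  ... | yes u≡v = ⊥-elim (u≢v u≡v)
  ... | no _ = refl

  exp-++ : ∀ a b v → exp (a ++ b) v ≡ exp a v ℕ.+ exp b v
  exp-++ [] b v = refl
  exp-++ (u ∷ a) b v with u ≟V v
  ... | yes _ = cong suc (exp-++ a b v)
  ... | no _ = exp-++ a b v

  exp≢0⇒∈ : ∀ m v → exp m v ≢ 0 → v ∈ m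
  exp≢0⇒∈ [] v ne = ⊥-elim (ne refl)
  exp≢0⇒∈ (u ∷ m) v ne with u ≟V v
  ... | yes refl = here refl
  ... | no _ = there (exp≢0⇒∈ m v ne)

  ∈⇒exp>0 : ∀ {m v} → v ∈ m → 1 ≤ exp m v
  ∈⇒exp>0 {u ∷ m} (here refl) rewrite exp-here u m = s≤s z≤n
  ∈⇒exp>0 {u ∷ m} {v} (there p) with u ≟V v
  ... | yes _ = s≤s z≤n
  ... | no _ = ∈⇒exp>0 p

  exp-pair≡0 : ∀ a b u → a ≢ u → b ≢ u → exp (a ∷ b ∷ []) u ≡ 0
  exp-pair≡0 a b u a≢u b≢u = trans (exp-there (b ∷ []) a≢u) (exp-there [] b≢u)

  ≈ₘ-refl : ∀ {m} → m ≈ₘ m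
  ≈ₘ-refl v = refl

  ≈ₘ-sym : ∀ {m m'} → m ≈ₘ m' → m' ≈ₘ m
  ≈ₘ-sym e v = sym (e v)

  ≈ₘ-trans : ∀ {a b c'} → a ≈ₘ b → b ≈ₘ c' → a ≈ₘ c'
  ≈ₘ-trans e f v = trans (e v) (f v)

  -- The boolean test _==ₘ_ decides _≈ₘ_: it compares the exponents of all
  -- variables occurring in m or m', and the others have exponent 0 on both sides.
  private
    compareOn : Mon → Mon → List V → Bool
    compareOn m m' L = foldr (λ v b → (exp m v ≡ᵇ exp m' v) ∧ b) true L

    compareOn-sound : ∀ m m' L → T (compareOn m m' L) → ∀ v → v ∈ L → exp m v ≡ exp m' v
    compareOn-sound m m' (u ∷ L) t v (here refl) with exp m u ≡ᵇ exp m' u in eq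
    ... | true = ℕP.≡ᵇ⇒≡ _ _ (subst T (sym eq) tt)
    compareOn-sound m m' (u ∷ L) t v (there p) with exp m u ≡ᵇ exp m' u
    ... | true = compareOn-sound m m' L t v p

    compareOn-complete : ∀ m m' L → m ≈ₘ m' → T (compareOn m m' L)
    compareOn-complete m m' [] e = tt
    compareOn-complete m m' (u ∷ L) e with exp m u ≡ᵇ exp m' u in eq
    ... | true = compareOn-complete m m' L e
    ... | false = subst T eq (ℕP.≡⇒≡ᵇ _ _ (e u))

  ==ₘ-sound : ∀ m m' → T (m ==ₘ m') → m ≈ₘ m'
  ==ₘ-sound m m' t v with exp m v ℕ.≟ 0 | exp m' v ℕ.≟ 0
  ... | yes m0 | yes m'0 = trans m0 (sym m'0)
  ... | no m≢0 | _ = compareOn-sound m m' (m ++ m') t v (∈-++⁺ˡ (exp≢0⇒∈ m v m≢0))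
  ... | yes _ | no m'≢0 = compareOn-sound m m' (m ++ m') t v (∈-++⁺ʳ m (exp≢0⇒∈ m' v m'≢0))

  ==ₘ-true : ∀ m m' → m ≈ₘ m' → (m ==ₘ m') ≡ true
  ==ₘ-true m m' e = BoolP.T-≡ .Equivalence.to (compareOn-complete m m' (m ++ m') e)

  ==ₘ-false : ∀ m m' → ¬ (m ≈ₘ m') → (m ==ₘ m') ≡ false
  ==ₘ-false m m' m≉m' with m ==ₘ m' in eq
  ... | true = ⊥-elim (m≉m' (==ₘ-sound m m' (subst T (sym eq) tt)))
  ... | false = refl

  _≈ₘ?_ : ∀ m m' → Dec (m ≈ₘ m')
  m ≈ₘ? m' with m ==ₘ m' in eq
  ... | true = yes (==ₘ-sound m m' (subst T (sym eq) tt))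
  ... | false = no λ e → subst T eq (compareOn-complete m m' (m ++ m') e)

  ==ₘ-resp : ∀ a b m → a ≈ₘ b → (a ==ₘ m) ≡ (b ==ₘ m)
  ==ₘ-resp a b m a≈b with a ≈ₘ? m
  ... | yes a≈m = trans (==ₘ-true a m a≈m) (sym (==ₘ-true b m (≈ₘ-trans {b} {a} {m} (≈ₘ-sym {a} {b} a≈b) a≈m)))
  ... | no a≉m = trans (==ₘ-false a m a≉m) (sym (==ₘ-false b m λ b≈m → a≉m (≈ₘ-trans {a} {b} {m} a≈b b≈m)))

  ≈ₘ⇒↭ : ∀ m m' → m ≈ₘ m' → m ↭ m'
  ≈ₘ⇒↭ [] [] e = Perm.refl
  ≈ₘ⇒↭ [] (u ∷ m') e with trans (e u) (exp-here u m')
  ... | ()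
  ≈ₘ⇒↭ (u ∷ m) m' e with ∈-∃++ (exp≢0⇒∈ m' u u∈m')
    where
      u∈m' : exp m' u ≢ 0
      u∈m' q with trans (sym (exp-here u m)) (trans (e u) q)
      ... | ()
  ... | ys , zs , refl = Perm.trans (prep u (≈ₘ⇒↭ m (ys ++ zs) e')) (Perm.↭-sym (shift u ys zs))
    where
      e' : m ≈ₘ (ys ++ zs)
      e' v with e v
      ... | q rewrite exp-++ ys (u ∷ zs) v | exp-++ ys zs v with u ≟V v
      ... | yes refl = ℕP.suc-injective (trans q (ℕP.+-suc (exp ys u) (exp zs u)))
      ... | no _ = q

  ↭⇒≈ₘ : ∀ {m m'} → m ↭ m' → m ≈ₘ m'
  ↭⇒≈ₘ Perm.refl v = refl
  ↭⇒≈ₘ (prep a p) v with a ≟V v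
  ... | yes _ = cong suc (↭⇒≈ₘ p v)
  ... | no _ = ↭⇒≈ₘ p v
  ↭⇒≈ₘ (swap a b p) v with a ≟V v | b ≟V v
  ... | yes _ | yes _ = cong (suc ∘ suc) (↭⇒≈ₘ p v)
  ... | yes _ | no _ = cong suc (↭⇒≈ₘ p v)
  ... | no _ | yes _ = cong suc (↭⇒≈ₘ p v)
  ... | no _ | no _ = ↭⇒≈ₘ p v
  ↭⇒≈ₘ (Perm.trans p q) v = trans (↭⇒≈ₘ p v) (↭⇒≈ₘ q v)

  deg-≈ₘ : ∀ {m m'} → m ≈ₘ m' → deg m ≡ deg m'
  deg-≈ₘ {m} {m'} e = ↭-length (≈ₘ⇒↭ m m' e)

  module Additive (M : CommutativeMonoid 0ℓ 0ℓ) where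
    open CommutativeMonoid M using (_≈_; _∙_; ε; ∙-cong; ∙-congˡ; assoc; comm; identityˡ; setoid)
      renaming (Carrier to A; refl to ≈-refl; sym to ≈-sym; trans to ≈-trans)
    open import Relation.Binary.Reasoning.Setoid setoid

    total : (V → A) → Mon → A
    total f [] = ε
    total f (v ∷ m) = f v ∙ total f m

    total-++ : ∀ f a b → total f (a ++ b) ≈ (total f a ∙ total f b)
    total-++ f [] b = ≈-sym (identityˡ _)
    total-++ f (v ∷ a) b = ≈-trans (∙-congˡ (total-++ f a b)) (≈-sym (assoc (f v) _ _))

    total-↭ : ∀ f {a b} → a ↭ b → total f a ≈ total f b
    total-↭ f Perm.refl = ≈-refl
    total-↭ f (prep v p) = ∙-congˡ (total-↭ f p)
    total-↭ f {u ∷ v ∷ xs} {_ ∷ _ ∷ ys} (swap u v p) = begin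
      f u ∙ (f v ∙ total f xs) ≈⟨ ≈-sym (assoc (f u) (f v) _) ⟩
      (f u ∙ f v) ∙ total f xs ≈⟨ ∙-cong (comm (f u) (f v)) (total-↭ f p) ⟩
      (f v ∙ f u) ∙ total f ys ≈⟨ assoc (f v) (f u) _ ⟩
      f v ∙ (f u ∙ total f ys) ∎
    total-↭ f (Perm.trans p q) = ≈-trans (total-↭ f p) (total-↭ f q)

    total-≈ₘ : ∀ f a b → a ≈ₘ b → total f a ≈ total f b
    total-≈ₘ f a b e = total-↭ f (≈ₘ⇒↭ a b e)

  ∣ₘ-refl : ∀ {m} → m ∣ₘ m
  ∣ₘ-refl v = ℕP.≤-refl

  ∣ₘ-trans : ∀ {a b c'} → a ∣ₘ b → b ∣ₘ c' → a ∣ₘ c'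
  ∣ₘ-trans p q v = ℕP.≤-trans (p v) (q v)

  ∣ₘ-respˡ : ∀ {a a' b} → a ≈ₘ a' → a ∣ₘ b → a' ∣ₘ b
  ∣ₘ-respˡ e p v = subst (_≤ _) (e v) (p v)

  pair∣ₘ : ∀ {u₁ u₂ m} → u₁ ≢ u₂ → u₁ ∈ m → u₂ ∈ m → (u₁ ∷ u₂ ∷ []) ∣ₘ m
  pair∣ₘ {u₁} {u₂} u₁≢u₂ p q v with u₁ ≟V v | u₂ ≟V v
  ... | yes refl | yes refl = ⊥-elim (u₁≢u₂ refl)
  ... | yes refl | no _ = ∈⇒exp>0 p
  ... | no _ | yes refl = ∈⇒exp>0 q
  ... | no _ | no _ = z≤n

  quotient : ∀ m w → m ∣ₘ w → Σ[ r ∈ Mon ] (w ≈ₘ (m ++ r))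
  quotient [] w m∣w = w , ≈ₘ-refl {w}
  quotient (u ∷ m) w m∣w with ∈-∃++ (exp≢0⇒∈ w u u∈w)
    where
      u∈w : exp w u ≢ 0
      u∈w q with subst (_≤ 0) (exp-here u m) (subst (exp (u ∷ m) u ≤_) q (m∣w u))
      ... | ()
  ... | ys , zs , refl with quotient m (ys ++ zs) m∣rest
    where
      m∣rest : m ∣ₘ (ys ++ zs)
      m∣rest v with m∣w v
      ... | q rewrite exp-++ ys (u ∷ zs) v | exp-++ ys zs v with u ≟V v
      ... | yes refl = ℕP.≤-pred (subst (suc (exp m u) ≤_) (ℕP.+-suc (exp ys u) (exp zs u)) q)
      ... | no _ = q
  ... | r , e = r , ≈ₘ-trans {ys ++ u ∷ zs} {u ∷ ys ++ zs} {u ∷ m ++ r} (↭⇒≈ₘ (shift u ys zs)) cons-e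
    where
      cons-e : (u ∷ (ys ++ zs)) ≈ₘ (u ∷ (m ++ r))
      cons-e v with u ≟V v
      ... | yes _ = cong suc (e v)
      ... | no _ = e v

  module Revlex (rank : V → ℕ) (rank-inj : InjectiveRank rank) where

    _≺_ : Mon → Mon → Set
    _≺_ = revlex rank

    ≺-irrefl : ∀ m → ¬ (m ≺ m)
    ≺-irrefl m (inj₁ p) = ℕP.<-irrefl refl p
    ≺-irrefl m (inj₂ (_ , v , p , _)) = ℕP.<-irrefl refl p

    ≺-resp : ∀ {a a' b b'} → a ≈ₘ a' → b ≈ₘ b' → a ≺ b → a' ≺ b'
    ≺-resp {a} {a'} {b} {b'} ea eb (inj₁ p) = inj₁ (subst₂ _<_ (deg-≈ₘ {a} {a'} ea) (deg-≈ₘ {b} {b'} eb) p)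
    ≺-resp {a} {a'} {b} {b'} ea eb (inj₂ (deg≡ , v , p , below)) =
      inj₂ (trans (sym (deg-≈ₘ {a} {a'} ea)) (trans deg≡ (deg-≈ₘ {b} {b'} eb)) ,
            v , subst₂ _<_ (eb v) (ea v) p ,
            λ u r → trans (sym (ea u)) (trans (below u r) (eb u)))

    -- the two monomials are compared at the variable of smaller rank
    ≺-trans : ∀ {a b c'} → a ≺ b → b ≺ c' → a ≺ c'
    ≺-trans (inj₁ p) (inj₁ q) = inj₁ (ℕP.<-trans p q)
    ≺-trans (inj₁ p) (inj₂ (deg≡ , _)) = inj₁ (subst (_ <_) deg≡ p)
    ≺-trans (inj₂ (deg≡ , _)) (inj₁ q) = inj₁ (subst (_< _) (sym deg≡) q)
    ≺-trans {a} {b} {c'} (inj₂ (deg≡₁ , v₁ , p₁ , below₁)) (inj₂ (deg≡₂ , v₂ , p₂ , below₂))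
      with ℕP.<-cmp (rank v₁) (rank v₂)
    ... | tri< r _ _ =
      inj₂ (trans deg≡₁ deg≡₂ , v₁ , subst (_< exp a v₁) (below₂ v₁ r) p₁ ,
            λ u s → trans (below₁ u s) (below₂ u (ℕP.<-trans s r)))
    ... | tri> _ _ r =
      inj₂ (trans deg≡₁ deg≡₂ , v₂ , subst (exp c' v₂ <_) (sym (below₁ v₂ r)) p₂ ,
            λ u s → trans (below₁ u (ℕP.<-trans s r)) (below₂ u s))
    ... | tri≈ _ r _ with rank-inj v₁ v₂ r
    ... | refl = inj₂ (trans deg≡₁ deg≡₂ , v₁ , ℕP.<-trans p₂ p₁ ,
                       λ u s → trans (below₁ u s) (below₂ u s))

    ≺-asym : ∀ {a b} → a ≺ b → ¬ (b ≺ a)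
    ≺-asym {a} {b} p q = ≺-irrefl a (≺-trans {a} {b} {a} p q)

    ≼-≺-trans : ∀ {a b c'} → (a ≈ₘ b) ⊎ (a ≺ b) → b ≺ c' → a ≺ c'
    ≼-≺-trans {a} {b} {c'} (inj₁ a≈b) b≺c = ≺-resp {b} {a} {c'} {c'} (≈ₘ-sym {a} {b} a≈b) (≈ₘ-refl {c'}) b≺c
    ≼-≺-trans {a} {b} {c'} (inj₂ a≺b) b≺c = ≺-trans {a} {b} {c'} a≺b b≺c

    ≺-*ʳ : ∀ {a b} c' → a ≺ b → (a ++ c') ≺ (b ++ c')
    ≺-*ʳ {a} {b} c' (inj₁ p) =
      inj₁ (subst₂ _<_ (sym (ListP.length-++ a)) (sym (ListP.length-++ b)) (ℕP.+-monoˡ-< (length c') p))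
    ≺-*ʳ {a} {b} c' (inj₂ (deg≡ , v , p , below)) =
      inj₂ (trans (ListP.length-++ a) (trans (cong (ℕ._+ length c') deg≡) (sym (ListP.length-++ b))) ,
            v , subst₂ _<_ (sym (exp-++ b c' v)) (sym (exp-++ a c' v)) (ℕP.+-monoˡ-< (exp c' v) p) ,
            λ u r → trans (exp-++ a c' u) (trans (cong (ℕ._+ exp c' u) (below u r)) (sym (exp-++ b c' u))))

    private
      Differ : Mon → Mon → V → Set
      Differ a b v = exp a v ≢ exp b v

      minimalDifference : ∀ a b (L : List V) →
        (∀ v → v ∈ L → exp a v ≡ exp b v) ⊎
        (Σ[ v ∈ V ] (Differ a b v × (∀ u → u ∈ L → Differ a b u → rank v ≤ rank u)))
      minimalDifference a b [] = inj₁ λ v ()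
      minimalDifference a b (u ∷ L) with minimalDifference a b L | exp a u ℕ.≟ exp b u
      ... | inj₁ same | yes e = inj₁ λ { v (here refl) → e ; v (there p) → same v p }
      ... | inj₁ same | no ne =
        inj₂ (u , ne , λ { u' (here refl) _ → ℕP.≤-refl ; u' (there p) d → ⊥-elim (d (same u' p)) })
      ... | inj₂ (v , d , min) | yes e =
        inj₂ (v , d , λ { u' (here refl) d' → ⊥-elim (d' e) ; u' (there p) d' → min u' p d' })
      ... | inj₂ (v , d , min) | no ne with rank u ℕ.<? rank v
      ... | yes r = inj₂ (u , ne , λ { u' (here refl) _ → ℕP.≤-refl
                                     ; u' (there p) d' → ℕP.≤-trans (ℕP.<⇒≤ r) (min u' p d') })
      ... | no r = inj₂ (v , d , λ { u' (here refl) _ → ℕP.≮⇒≥ r ; u' (there p) d' → min u' p d' })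

      differ∈ : ∀ a b v → Differ a b v → v ∈ (a ++ b)
      differ∈ a b v d with exp a v ℕ.≟ 0
      ... | no a≢0 = ∈-++⁺ˡ (exp≢0⇒∈ a v a≢0)
      ... | yes a≡0 = ∈-++⁺ʳ a (exp≢0⇒∈ b v λ b≡0 → d (trans a≡0 (sym b≡0)))

      agreeBelow : ∀ a b v → (∀ u → u ∈ (a ++ b) → Differ a b u → rank v ≤ rank u) →
                   ∀ u → rank u < rank v → exp a u ≡ exp b u
      agreeBelow a b v min u s with exp a u ℕ.≟ exp b u
      ... | yes e = e
      ... | no d = ⊥-elim (ℕP.<⇒≱ s (min u (differ∈ a b u d) d))

    compare : ∀ a b → (a ≈ₘ b) ⊎ (a ≺ b) ⊎ (b ≺ a)
    compare a b with ℕP.<-cmp (deg a) (deg b)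
    ... | tri< r _ _ = inj₂ (inj₁ (inj₁ r))
    ... | tri> _ _ r = inj₂ (inj₂ (inj₁ r))
    ... | tri≈ _ deg≡ _ with minimalDifference a b (a ++ b)
    ... | inj₁ same = inj₁ equal
      where
        equal : a ≈ₘ b
        equal v with exp a v ℕ.≟ exp b v
        ... | yes e = e
        ... | no d = same v (differ∈ a b v d)
    ... | inj₂ (v , d , min) with ℕP.<-cmp (exp a v) (exp b v)
    ... | tri≈ _ e _ = ⊥-elim (d e)
    ... | tri> _ _ r = inj₂ (inj₁ (inj₂ (deg≡ , v , r , agreeBelow a b v min)))
    ... | tri< r _ _ = inj₂ (inj₂ (inj₂ (sym deg≡ , v , r , λ u s → sym (agreeBelow a b v min u s))))

    ≺-by-minimal : ∀ t l v → (∀ u → ¬ (rank u < rank v)) → deg t ≡ deg l → exp l v < exp t v → t ≺ l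
    ≺-by-minimal t l v v-min deg≡ p = inj₂ (deg≡ , v , p , λ u r → ⊥-elim (v-min u r))

    pair-≺ : ∀ a b Y₁ Y₂ → rank a ≤ rank b → rank a < rank Y₁ → rank a < rank Y₂ →
             (a ∷ b ∷ []) ≺ (Y₁ ∷ Y₂ ∷ [])
    pair-≺ a b Y₁ Y₂ a≤b a<Y₁ a<Y₂ = inj₂ (refl , a , a-excess , below)
      where
        rank-≢ : ∀ {u v} → rank u < rank v → v ≢ u
        rank-≢ r refl = ℕP.<-irrefl refl r
        a-excess : exp (Y₁ ∷ Y₂ ∷ []) a < exp (a ∷ b ∷ []) a
        a-excess rewrite exp-pair≡0 Y₁ Y₂ a (rank-≢ a<Y₁) (rank-≢ a<Y₂) | exp-here a (b ∷ []) = s≤s z≤n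
        below : ∀ u → rank u < rank a → exp (a ∷ b ∷ []) u ≡ exp (Y₁ ∷ Y₂ ∷ []) u
        below u r = trans (exp-pair≡0 a b u (rank-≢ r) (rank-≢ (ℕP.<-≤-trans r a≤b)))
                          (sym (exp-pair≡0 Y₁ Y₂ u (rank-≢ (ℕP.<-trans r a<Y₁)) (rank-≢ (ℕP.<-trans r a<Y₂))))

    _≺?_ : ∀ a b → Dec (a ≺ b)
    a ≺? b with compare a b
    ... | inj₁ a≈b = no λ a≺b → ≺-irrefl b (≺-resp {a} {b} {b} {b} a≈b (≈ₘ-refl {b}) a≺b)
    ... | inj₂ (inj₁ a≺b) = yes a≺b
    ... | inj₂ (inj₂ b≺a) = no (≺-asym {b} {a} b≺a)

  open Field K using (Carrier; _≈_; 0#; 1#; -‿inverseʳ; +-cong; +-identityʳ; +-assoc; +-comm; 1≉0; setoid)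
    renaming (_+_ to _+K_; refl to ≈-refl; sym to ≈-sym; trans to ≈-trans; reflexive to ≈-reflexive)

  Closed : (Mon → Bool) → Set
  Closed P = ∀ a b → a ≈ₘ b → P a ≡ P b

  sumWhere-cong : ∀ (P Q : Mon → Bool) f → (∀ m → P m ≡ Q m) → sumWhere P f ≡ sumWhere Q f
  sumWhere-cong P Q [] e = refl
  sumWhere-cong P Q ((a , m) ∷ f) e rewrite e m | sumWhere-cong P Q f e = refl

  sumWhere-empty : ∀ (P : Mon → Bool) f → (∀ a m → (a , m) ∈ f → P m ≡ false) → sumWhere P f ≈ 0#
  sumWhere-empty P [] h = ≈-refl
  sumWhere-empty P ((a , m) ∷ f) h rewrite h a m (here refl) =
    sumWhere-empty P f (λ a' m' p → h a' m' (there p))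

  sumWhere-split : ∀ (P Q : Mon → Bool) f →
    sumWhere P f ≈ (sumWhere (λ w → P w ∧ Q w) f +K sumWhere (λ w → P w ∧ not (Q w)) f)
  sumWhere-split P Q [] = ≈-sym (+-identityʳ 0#)
  sumWhere-split P Q ((a , m) ∷ f) with P m | Q m
  ... | false | _ = sumWhere-split P Q f
  ... | true | true = ≈-trans (+-cong ≈-refl (sumWhere-split P Q f)) (≈-sym (+-assoc a _ _))
  ... | true | false = begin
      a +K sumWhere P f   ≈⟨ +-cong ≈-refl (sumWhere-split P Q f) ⟩
      a +K (A +K B)       ≈⟨ ≈-sym (+-assoc a A B) ⟩
      (a +K A) +K B       ≈⟨ +-cong (+-comm a A) ≈-refl ⟩
      (A +K a) +K B       ≈⟨ +-assoc A a B ⟩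
      A +K (a +K B)       ∎
    where
      open import Relation.Binary.Reasoning.Setoid setoid
      A = sumWhere (λ w → P w ∧ Q w) f
      B = sumWhere (λ w → P w ∧ not (Q w)) f

  -- If every monomial of a closed class P that occurs in f has coefficient 0,
  -- then the coefficients of f over P sum to 0 (group the terms by monomial).
  classSum-zero : ∀ (P : Mon → Bool) f → Closed P →
    (∀ a w → (a , w) ∈ f → T (P w) → coeff f w ≈ 0#) → sumWhere P f ≈ 0#
  classSum-zero P [] closed h = ≈-refl
  classSum-zero P ((a , w₁) ∷ f) closed h with P w₁ in eqP
  ... | false = classSum-zero P f closed h'
    where
      h' : ∀ a' w → (a' , w) ∈ f → T (P w) → coeff f w ≈ 0#
      h' a' w p t with w₁ ==ₘ w in eq
      ... | true = ⊥-elim (subst T (trans (closed w w₁ (≈ₘ-sym {w₁} {w} (==ₘ-sound w₁ w (subst T (sym eq) tt)))) eqP) t)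
      ... | false = ≈-trans (≈-sym (≈-reflexive (coeff-skip eq))) (h a' w (there p) t)
        where
          coeff-skip : (w₁ ==ₘ w) ≡ false → coeff ((a , w₁) ∷ f) w ≡ coeff f w
          coeff-skip e rewrite e = refl
  ... | true =
    ≈-trans (≈-reflexive unfold)
      (≈-trans (sumWhere-split P Q ((a , w₁) ∷ f)) (≈-trans (+-cong classOfw₁ others) (+-identityʳ 0#)))
    where
      unfold : (a +K sumWhere P f) ≡ sumWhere P ((a , w₁) ∷ f)
      unfold rewrite eqP = refl
      Q = λ m → m ==ₘ w₁
      -- the terms equivalent to w₁ sum to the coefficient of w₁, which is 0
      classOfw₁ : sumWhere (λ m → P m ∧ Q m) ((a , w₁) ∷ f) ≈ 0#
      classOfw₁ = ≈-trans (≈-reflexive (sumWhere-cong _ Q ((a , w₁) ∷ f) P∧Q≡Q)) (h a w₁ (here refl) (subst T (sym eqP) tt))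
        where
          P∧Q≡Q : ∀ m → (P m ∧ Q m) ≡ Q m
          P∧Q≡Q m with m ≈ₘ? w₁
          ... | yes e rewrite closed m w₁ e | eqP = refl
          ... | no ne rewrite ==ₘ-false m w₁ ne = BoolP.∧-zeroʳ (P m)
      P′ = λ m → P m ∧ not (Q m)
      P′-closed : Closed P′
      P′-closed a' b' e rewrite closed a' b' e | ==ₘ-resp a' b' w₁ e = refl
      -- the remaining terms form a shorter list satisfying the same hypothesis
      others : sumWhere P′ ((a , w₁) ∷ f) ≈ 0#
      others rewrite eqP | ==ₘ-true w₁ w₁ (≈ₘ-refl {w₁}) = classSum-zero P′ f P′-closed h′
        where
          h′ : ∀ a' w → (a' , w) ∈ f → T (P′ w) → coeff f w ≈ 0#
          h′ a' w p t with w ≈ₘ? w₁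
          ... | yes e rewrite ==ₘ-true w w₁ e | BoolP.∧-zeroʳ (P w) = ⊥-elim t
          ... | no ne = ≈-trans (≈-sym coeff-skip) (h a' w (there p) (BoolP.T-∧ .Equivalence.to t .proj₁))
            where
              coeff-skip : coeff ((a , w₁) ∷ f) w ≈ coeff f w
              coeff-skip rewrite ==ₘ-false w₁ w (λ e → ne (≈ₘ-sym {w₁} {w} e)) = ≈-refl

  ¬¬-∀∈ : ∀ {a q} {A : Set a} (Q : A → Set q) (us : List A) →
    (∀ u → u ∈ us → ¬ ¬ Q u) → ¬ ¬ (∀ u → u ∈ us → Q u)
  ¬¬-∀∈ Q [] h k = k (λ _ ())
  ¬¬-∀∈ Q (u ∷ us) h k =
    h u (here refl) λ Qu → ¬¬-∀∈ Q us (λ v v∈ → h v (there v∈)) λ Q-rest →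
    k λ { v (here refl) → Qu ; v (there v∈) → Q-rest v v∈ }

  module Leading (rank : V → ℕ) (rank-inj : InjectiveRank rank) where
    open Revlex rank rank-inj

    binom-leading : ∀ m₁ m₂ → m₂ ≺ m₁ → IsLeading _≺_ (binom m₁ m₂) m₁
    binom-leading m₁ m₂ m₂≺m₁ = nonzero , below
      where
        m₂≉m₁ : ¬ (m₂ ≈ₘ m₁)
        m₂≉m₁ e = ≺-irrefl m₁ (≺-resp {m₂} {m₁} {m₁} {m₁} e (≈ₘ-refl {m₁}) m₂≺m₁)
        nonzero : ¬ (coeff (binom m₁ m₂) m₁ ≈ 0#)
        nonzero q rewrite ==ₘ-true m₁ m₁ (≈ₘ-refl {m₁}) | ==ₘ-false m₂ m₁ m₂≉m₁ =
          1≉0 (≈-trans (≈-sym (+-identityʳ 1#)) q)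
        below : ∀ m' → ¬ (coeff (binom m₁ m₂) m' ≈ 0#) → (m' ≈ₘ m₁) ⊎ (m' ≺ m₁)
        below m' q with m' ≈ₘ? m₁ | m' ≈ₘ? m₂
        ... | yes e | _ = inj₁ e
        ... | no _ | yes e = inj₂ (≺-resp {m₂} {m'} {m₁} {m₁} (≈ₘ-sym {m'} {m₂} e) (≈ₘ-refl {m₁}) m₂≺m₁)
        ... | no ne₁ | no ne₂
          rewrite ==ₘ-false m₁ m' (λ e → ne₁ (≈ₘ-sym {m₁} {m'} e)) | ==ₘ-false m₂ m' (λ e → ne₂ (≈ₘ-sym {m₂} {m'} e)) =
          ⊥-elim (q ≈-refl)

    leading-unique : ∀ f a b → IsLeading _≺_ f a → IsLeading _≺_ f b → a ≈ₘ b
    leading-unique f a b (a≠0 , below-a) (b≠0 , below-b) with below-a b b≠0 | below-b a a≠0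
    ... | inj₁ b≈a | _ = ≈ₘ-sym {b} {a} b≈a
    ... | inj₂ _ | inj₁ a≈b = a≈b
    ... | inj₂ b≺a | inj₂ a≺b = ⊥-elim (≺-asym {b} {a} b≺a a≺b)

    cancelling-partner : ∀ (P : Mon → Bool) f m → Closed P → T (P m) → sumWhere P f ≈ 0# →
      IsLeading _≺_ f m → Σ[ aw ∈ Carrier × Mon ] (aw ∈ f × T (P (proj₂ aw)) × proj₂ aw ≺ m)
    cancelling-partner P f m closed Pm sum≈0 (m≠0 , below)
      with any? (λ aw → T? (P (proj₂ aw)) ×-dec (proj₂ aw ≺? m)) f
    ... | yes partner = find partner
    ... | no none = ⊥-elim (¬¬-∀∈ Vanishes f vanish λ all → m≠0 (coeff-m≈0 λ a w aw∈f → all (a , w) aw∈f))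
      where
        -- without a partner, every term of P other than m vanishes, so the
        -- coefficient of m equals the vanishing sum over P
        Q = λ w → w ==ₘ m
        P′ = λ w → P w ∧ not (Q w)
        P′-closed : Closed P′
        P′-closed a b e rewrite closed a b e | ==ₘ-resp a b m e = refl
        Vanishes : Carrier × Mon → Set ℓ
        Vanishes (_ , w) = T (P′ w) → coeff f w ≈ 0#
        -- a nonzero term of P′ would be a partner, since m is leading
        vanish : ∀ aw → aw ∈ f → ¬ ¬ Vanishes aw
        vanish (a , w) aw∈f not-vanish = not-vanish λ t → ⊥-elim (¬¬vanishes t λ w≈0 → not-vanish λ _ → w≈0)
          where
            ¬¬vanishes : T (P′ w) → ¬ ¬ (coeff f w ≈ 0#)
            ¬¬vanishes t w≠0 with below w w≠0
            ... | inj₁ e rewrite ==ₘ-true w m e | BoolP.∧-zeroʳ (P w) = t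
            ... | inj₂ w≺m = none (lose aw∈f (BoolP.T-∧ .Equivalence.to t .proj₁ , w≺m))
        coeff-as-sum : coeff f m ≡ sumWhere (λ w → P w ∧ Q w) f
        coeff-as-sum = sym (sumWhere-cong _ Q f P∧Q≡Q)
          where
            P∧Q≡Q : ∀ w → (P w ∧ Q w) ≡ Q w
            P∧Q≡Q w with w ≈ₘ? m
            ... | yes e rewrite closed w m e | ==ₘ-true w m e = trans (BoolP.∧-identityʳ (P m)) (BoolP.T-≡ .Equivalence.to Pm)
            ... | no ne rewrite ==ₘ-false w m ne = BoolP.∧-zeroʳ (P w)
        coeff-m≈0 : (∀ a w → (a , w) ∈ f → T (P′ w) → coeff f w ≈ 0#) → coeff f m ≈ 0#
        coeff-m≈0 all = begin
          coeff f m                                                 ≈⟨ ≈-sym (+-identityʳ _) ⟩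
          coeff f m +K 0#                                           ≈⟨ +-cong (≈-reflexive coeff-as-sum)
                                                                               (≈-sym (classSum-zero P′ f P′-closed all)) ⟩
          sumWhere (λ w → P w ∧ Q w) f +K sumWhere P′ f              ≈⟨ ≈-sym (sumWhere-split P Q f) ⟩
          sumWhere P f                                              ≈⟨ sum≈0 ⟩
          0#                                                        ∎
          where open import Relation.Binary.Reasoning.Setoid setoid

  module ToricKernel {d : ℕ} (wt : V → Fin d → ℤ) where
    open Toric wt
    open Additive ℤP.+-0-commutativeMonoid using (total; total-++; total-≈ₘ)

    tvec≡total : ∀ m i → tvec m i ≡ total (λ v → wt v i) m
    tvec≡total [] i = refl
    tvec≡total (v ∷ m) i = cong (λ t → wt v i ℤ.+ t) (tvec≡total m i)

    tvec-++ : ∀ a b i → tvec (a ++ b) i ≡ tvec a i ℤ.+ tvec b i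
    tvec-++ a b i = begin
      tvec (a ++ b) i                                   ≡⟨ tvec≡total (a ++ b) i ⟩
      total (λ v → wt v i) (a ++ b)                     ≡⟨ total-++ (λ v → wt v i) a b ⟩
      total (λ v → wt v i) a ℤ.+ total (λ v → wt v i) b ≡⟨ sym (cong₂ ℤ._+_ (tvec≡total a i) (tvec≡total b i)) ⟩
      tvec a i ℤ.+ tvec b i                             ∎
      where open ≡.≡-Reasoning

    tvec-≈ₘ : ∀ a b → a ≈ₘ b → ∀ i → tvec a i ≡ tvec b i
    tvec-≈ₘ a b e i = trans (tvec≡total a i) (trans (total-≈ₘ (λ v → wt v i) a b e) (sym (tvec≡total b i)))

    -- the fibre of π over the Laurent monomial t^u s^k
    InFibre : (Fin d → ℤ) → ℕ → Mon → Bool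
    InFibre u k m = allFin (λ i → ⌊ tvec m i ℤ.≟ u i ⌋) ∧ (deg m ≡ᵇ k)

    InFibre-cong : ∀ u k a b → (∀ i → tvec a i ≡ tvec b i) → deg a ≡ deg b → InFibre u k a ≡ InFibre u k b
    InFibre-cong u k a b tvec≡ deg≡ =
      cong₂ _∧_ (allFin-cong _ _ (λ i → cong (λ t → ⌊ t ℤ.≟ u i ⌋) (tvec≡ i))) (cong (_≡ᵇ k) deg≡)

    InFibre-closed : ∀ u k → Closed (InFibre u k)
    InFibre-closed u k a b e = InFibre-cong u k a b (tvec-≈ₘ a b e) (deg-≈ₘ {a} {b} e)

    InFibre-sound : ∀ u k w → T (InFibre u k w) → (∀ i → tvec w i ≡ u i) × deg w ≡ k
    InFibre-sound u k w t with BoolP.T-∧ .Equivalence.to t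
    ... | t-part , deg-part =
      (λ i → toWitness (allFin-sound (λ i → ⌊ tvec w i ℤ.≟ u i ⌋) t-part i)) , ℕP.≡ᵇ⇒≡ (deg w) k deg-part

    InFibre-self : ∀ m → T (InFibre (tvec m) (deg m) m)
    InFibre-self m = BoolP.T-∧ .Equivalence.from
      (allFin-complete _ (λ i → fromWitness {a? = tvec m i ℤ.≟ tvec m i} refl) , ℕP.≡⇒≡ᵇ (deg m) (deg m) refl)

    binom-ker : ∀ a b → (∀ i → tvec a i ≡ tvec b i) → deg a ≡ deg b → InKer (binom a b)
    binom-ker a b tvec≡ deg≡ u k with InFibre u k a | InFibre u k b | InFibre-cong u k a b tvec≡ deg≡
    ... | true | .true | refl = ≈-trans (+-cong ≈-refl (+-identityʳ _)) (-‿inverseʳ 1#)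
    ... | false | .false | refl = ≈-refl

    -- The leading monomial m of an element of ker π is cancelled within its
    -- fibre, so f has a term with the same π-image as m strictly below m.
    kernel-partner : ∀ (rank : V → ℕ) (rank-inj : InjectiveRank rank) f m → InKer f →
      IsLeading (revlex rank) f m →
      Σ[ w ∈ Mon ] ((∀ i → tvec w i ≡ tvec m i) × deg w ≡ deg m × revlex rank w m)
    kernel-partner rank rank-inj f m f∈ker m-lead
      with Leading.cancelling-partner rank rank-inj (InFibre (tvec m) (deg m)) f m
             (InFibre-closed (tvec m) (deg m)) (InFibre-self m) (f∈ker (tvec m) (deg m)) m-lead
    ... | (_ , w) , _ , w∈fibre , w≺m with InFibre-sound (tvec m) (deg m) w w∈fibre
    ... | tvec≡ , deg≡ = w , tvec≡ , deg≡ , w≺m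

module Renaming {c ℓ : Level} (K : Field c ℓ) {W V : Set}
    (_≟W_ : DecidableEquality W) (_≟V_ : DecidableEquality V)
    (φ : W → V) (ψ : V → W) (ψ∘φ : ∀ w → ψ (φ w) ≡ w) where
  module PW = PolyTheory K _≟W_
  module PV = PolyTheory K _≟V_
  module MW = Monomials K _≟W_
  module MV = Monomials K _≟V_
  open Field K using (_≈_; 0#) renaming (trans to ≈-trans; reflexive to ≈-reflexive)

  φ-injective : ∀ {a b} → φ a ≡ φ b → a ≡ b
  φ-injective {a} {b} e = trans (sym (ψ∘φ a)) (trans (cong ψ e) (ψ∘φ b))

  InImage : V → Set
  InImage u = u ≡ φ (ψ u)

  inImage? : ∀ u → Dec (InImage u)
  inImage? u = u ≟V φ (ψ u)

  exp-φ : ∀ m v → PV.exp (map φ m) (φ v) ≡ PW.exp m v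
  exp-φ [] v = refl
  exp-φ (u ∷ m) v with φ u ≟V φ v | u ≟W v
  ... | yes _ | yes _ = cong suc (exp-φ m v)
  ... | no _ | no _ = exp-φ m v
  ... | yes e | no ne = ⊥-elim (ne (φ-injective e))
  ... | no ne | yes e = ⊥-elim (ne (cong φ e))

  exp-outside : ∀ m u → ¬ InImage u → PV.exp (map φ m) u ≡ 0
  exp-outside [] u u∉ = refl
  exp-outside (w ∷ m) u u∉ with φ w ≟V u
  ... | yes refl = ⊥-elim (u∉ (cong φ (sym (ψ∘φ w))))
  ... | no _ = exp-outside m u u∉

  ≈ₘ-map : ∀ m m' → m PW.≈ₘ m' → map φ m PV.≈ₘ map φ m'
  ≈ₘ-map m m' e u with inImage? u
  ... | yes u∈ rewrite u∈ = trans (exp-φ m (ψ u)) (trans (e (ψ u)) (sym (exp-φ m' (ψ u))))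
  ... | no u∉ = trans (exp-outside m u u∉) (sym (exp-outside m' u u∉))

  ≈ₘ-unmap : ∀ m m' → map φ m PV.≈ₘ map φ m' → m PW.≈ₘ m'
  ≈ₘ-unmap m m' e v = trans (sym (exp-φ m v)) (trans (e (φ v)) (exp-φ m' v))

  ==ₘ-map : ∀ m m' → (map φ m PV.==ₘ map φ m') ≡ (m PW.==ₘ m')
  ==ₘ-map m m' with m MW.≈ₘ? m'
  ... | yes e = trans (MV.==ₘ-true (map φ m) (map φ m') (≈ₘ-map m m' e)) (sym (MW.==ₘ-true m m' e))
  ... | no ne = trans (MV.==ₘ-false (map φ m) (map φ m') (ne ∘ ≈ₘ-unmap m m')) (sym (MW.==ₘ-false m m' ne))

  ∣ₘ-map : ∀ m m' → m PW.∣ₘ m' → map φ m PV.∣ₘ map φ m'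
  ∣ₘ-map m m' m∣m' u with inImage? u
  ... | yes u∈ rewrite u∈ | exp-φ m (ψ u) | exp-φ m' (ψ u) = m∣m' (ψ u)
  ... | no u∉ rewrite exp-outside m u u∉ = z≤n

  sumWhere-map : ∀ (P : PV.Mon → Bool) f → PV.sumWhere P (PW.mapPoly φ f) ≡ PW.sumWhere (P ∘ map φ) f
  sumWhere-map P [] = refl
  sumWhere-map P ((a , m) ∷ f) rewrite sumWhere-map P f = refl

  coeff-map : ∀ h m → PV.coeff (PW.mapPoly φ h) (map φ m) ≡ PW.coeff h m
  coeff-map h m = trans (sumWhere-map _ h) (MW.sumWhere-cong _ _ h (λ m' → ==ₘ-map m' m))

  all-inImage? : ∀ w → Dec (All InImage w)
  all-inImage? [] = yes []
  all-inImage? (u ∷ w) with inImage? u | all-inImage? w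
  ... | yes p | yes q = yes (p ∷ q)
  ... | no np | _ = no λ { (p ∷ _) → np p }
  ... | yes _ | no nq = no λ { (_ ∷ q) → nq q }

  all-inImage⇒ : ∀ w → All InImage w → w ≡ map φ (map ψ w)
  all-inImage⇒ [] [] = refl
  all-inImage⇒ (u ∷ w) (p ∷ q) = cong₂ _∷_ p (all-inImage⇒ w q)

  not-all-inImage : ∀ w → ¬ All InImage w → Σ[ u ∈ V ] (u ∈ w × ¬ InImage u)
  not-all-inImage [] n = ⊥-elim (n [])
  not-all-inImage (u ∷ w) n with inImage? u
  ... | no u∉ = u , here refl , u∉
  ... | yes p with not-all-inImage w (λ q → n (p ∷ q))
  ... | (u' , u'∈w , u'∉) = u' , there u'∈w , u'∉

  coeff-outside : ∀ h w → ¬ All InImage w → PV.coeff (PW.mapPoly φ h) w ≈ 0#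
  coeff-outside h w not-all with not-all-inImage w not-all
  ... | (u , u∈w , u∉) =
    ≈-trans (≈-reflexive (sumWhere-map _ h))
            (MW.sumWhere-empty _ h λ a m _ → MV.==ₘ-false (map φ m) w (u-missing m))
    where
      u-missing : ∀ m → ¬ (map φ m PV.≈ₘ w)
      u-missing m e with trans (sym (e u)) (exp-outside m u u∉) | MV.∈⇒exp>0 {w} {u} u∈w
      ... | exp≡0 | exp>0 rewrite exp≡0 with exp>0
      ... | ()

  module Orders (rW : W → ℕ) (rV : V → ℕ) (injW : PW.InjectiveRank rW) (injV : PV.InjectiveRank rV)
      (φ-mono : ∀ a b → rW a < rW b → rV (φ a) < rV (φ b)) where

    φ-reflects-rank : ∀ a b → rV (φ a) < rV (φ b) → rW a < rW b
    φ-reflects-rank a b r with ℕP.<-cmp (rW a) (rW b)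
    ... | tri< s _ _ = s
    ... | tri≈ _ s _ rewrite injW a b s = ⊥-elim (ℕP.<-irrefl refl r)
    ... | tri> _ _ s = ⊥-elim (ℕP.<-asym r (φ-mono b a s))

    ≺-map : ∀ a b → PW.revlex rW a b → PV.revlex rV (map φ a) (map φ b)
    ≺-map a b (inj₁ p) = inj₁ (subst₂ _<_ (sym (ListP.length-map φ a)) (sym (ListP.length-map φ b)) p)
    ≺-map a b (inj₂ (deg≡ , v , p , below)) =
      inj₂ (trans (ListP.length-map φ a) (trans deg≡ (sym (ListP.length-map φ b))) ,
            φ v , subst₂ _<_ (sym (exp-φ b v)) (sym (exp-φ a v)) p , below′)
      where
        below′ : ∀ u → rV u < rV (φ v) → PV.exp (map φ a) u ≡ PV.exp (map φ b) u
        below′ u r with inImage? u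
        ... | no u∉ = trans (exp-outside a u u∉) (sym (exp-outside b u u∉))
        ... | yes u∈ rewrite u∈ =
          trans (exp-φ a (ψ u)) (trans (below (ψ u) (φ-reflects-rank (ψ u) v r)) (sym (exp-φ b (ψ u))))

    ≺-reflect : ∀ a b → PV.revlex rV (map φ a) (map φ b) → PW.revlex rW a b
    ≺-reflect a b (inj₁ p) = inj₁ (subst₂ _<_ (ListP.length-map φ a) (ListP.length-map φ b) p)
    ≺-reflect a b (inj₂ (deg≡ , v , p , below)) with inImage? v
    ... | no v∉ rewrite exp-outside a v v∉ | exp-outside b v v∉ = ⊥-elim (ℕP.<-irrefl refl p)
    ... | yes v∈ =
      inj₂ (trans (sym (ListP.length-map φ a)) (trans deg≡ (ListP.length-map φ b)) ,
            ψ v , subst₂ _<_ (exp-φ b (ψ v)) (exp-φ a (ψ v)) (subst (λ t → PV.exp (map φ b) t < PV.exp (map φ a) t) v∈ p) ,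
            λ u r → trans (sym (exp-φ a u)) (trans (below (φ u) (subst (λ t → rV (φ u) < rV t) (sym v∈) (φ-mono u (ψ v) r))) (exp-φ b u)))

    leading-map : ∀ h m → PW.IsLeading (PW.revlex rW) h m → PV.IsLeading (PV.revlex rV) (PW.mapPoly φ h) (map φ m)
    leading-map h m (m≠0 , below) = (λ q → m≠0 (≈-trans (≈-reflexive (sym (coeff-map h m))) q)) , below′
      where
        below′ : ∀ w → ¬ (PV.coeff (PW.mapPoly φ h) w ≈ 0#) → (w PV.≈ₘ map φ m) ⊎ PV.revlex rV w (map φ m)
        below′ w w≠0 with all-inImage? w
        ... | no not-all = ⊥-elim (w≠0 (coeff-outside h w not-all))
        ... | yes all rewrite all-inImage⇒ w all
          with below (map ψ w) (λ q → w≠0 (≈-trans (≈-reflexive (coeff-map h (map ψ w))) q))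
        ... | inj₁ e = inj₁ (≈ₘ-map (map ψ w) m e)
        ... | inj₂ lt = inj₂ (≺-map (map ψ w) m lt)

    leading-reflect : ∀ h w → PV.IsLeading (PV.revlex rV) (PW.mapPoly φ h) w →
      Σ[ m ∈ PW.Mon ] (w ≡ map φ m × PW.IsLeading (PW.revlex rW) h m)
    leading-reflect h w (w≠0 , below) with all-inImage? w
    ... | no not-all = ⊥-elim (w≠0 (coeff-outside h w not-all))
    ... | yes all = map ψ w , w≡ , m≠0 , below′
      where
        w≡ = all-inImage⇒ w all
        m≠0 : ¬ (PW.coeff h (map ψ w) ≈ 0#)
        m≠0 q = w≠0 (≈-trans (≈-reflexive (trans (cong (PV.coeff (PW.mapPoly φ h)) w≡) (coeff-map h (map ψ w)))) q)
        below′ : ∀ m' → ¬ (PW.coeff h m' ≈ 0#) → (m' PW.≈ₘ map ψ w) ⊎ PW.revlex rW m' (map ψ w)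
        below′ m' m'≠0 with below (map φ m') (λ q → m'≠0 (≈-trans (≈-reflexive (sym (coeff-map h m'))) q))
        ... | inj₁ e = inj₁ (≈ₘ-unmap m' (map ψ w) (subst (map φ m' PV.≈ₘ_) w≡ e))
        ... | inj₂ lt = inj₂ (≺-reflect m' (map ψ w) (subst (PV.revlex rV (map φ m')) w≡ lt))

module Variables {d : ℕ} (G : Graph d) where

  unsign : RVar G → SVar G
  unsign z = zS
  unsign (x i _) = xS i
  unsign (y i j p e _ _) = yS i j p e

  unsign∘φ : ∀ ε v → unsign (φ ε v) ≡ v
  unsign∘φ ε zS = refl
  unsign∘φ ε (xS i) = refl
  unsign∘φ ε (yS i j p e) = refl

  y-irrelevant : ∀ i j p p' e e' α β → y {G = G} i j p e α β ≡ y i j p' e' α β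
  y-irrelevant i j p p' e e' α β rewrite ℕP.<-irrelevant p p' | T-irr (adj G i j) e e' = refl

  yv-< : ∀ i j (p : i Fin.< j) e α β → yv {G = G} i j e α β ≡ y i j p e α β
  yv-< i j p e α β with FinP.<-cmp i j
  ... | tri< p' _ _ = y-irrelevant i j p' p e e α β
  ... | tri≈ ¬p _ _ = ⊥-elim (¬p p)
  ... | tri> ¬p _ _ = ⊥-elim (¬p p)

  yv-> : ∀ i j (p : j Fin.< i) e α β → yv {G = G} i j e α β ≡ y j i p (subst T (adj-sym G i j) e) β α
  yv-> i j p e α β with FinP.<-cmp i j
  ... | tri< _ _ ¬p = ⊥-elim (¬p p)
  ... | tri≈ _ _ ¬p = ⊥-elim (¬p p)
  ... | tri> _ _ p' = y-irrelevant j i p' p _ _ β α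

  YShape : Fin d → Fin d → Sgn → Sgn → RVar G → Set
  YShape i j α β v = (Σ[ p ∈ i Fin.< j ] Σ[ e ∈ T (adj G i j) ] (v ≡ y i j p e α β)) ⊎
                     (Σ[ p ∈ j Fin.< i ] Σ[ e ∈ T (adj G j i) ] (v ≡ y j i p e β α))

  yv-shape : ∀ i j e α β → YShape i j α β (yv i j e α β)
  yv-shape i j e α β with FinP.<-cmp i j
  ... | tri< p _ _ = inj₁ (p , e , refl)
  ... | tri≈ _ refl _ = ⊥-elim (subst T (adj-irrefl G i) e)
  ... | tri> _ _ p = inj₂ (p , _ , refl)

  IsY : RVar G → Set
  IsY (y _ _ _ _ _ _) = ⊤
  IsY _ = ⊥

  yv-isY : ∀ i j e α β → IsY (yv i j e α β)
  yv-isY i j e α β = isY (yv-shape i j e α β)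
    where
      isY : ∀ {v} → YShape i j α β v → IsY v
      isY (inj₁ (_ , _ , refl)) = tt
      isY (inj₂ (_ , _ , refl)) = tt

  yv≢x : ∀ i j e α β k γ → yv i j e α β ≢ x k γ
  yv≢x i j e α β k γ eq = subst IsY eq (yv-isY i j e α β)

  yv≢z : ∀ i j e α β → yv i j e α β ≢ z
  yv≢z i j e α β eq = subst IsY eq (yv-isY i j e α β)

module Setting {c ℓ : Level} (K : Field c ℓ) {d : ℕ} (G : Graph d)
    (rS : SVar G → ℕ) (rR : RVar G → ℕ) (goodS : GoodRankS G rS) (goodR : GoodRankR G rS rR) where
  open Variables G
  module PRG = PolyTheory K (_≟R_ {G = G})
  module PSG = PolyTheory K (_≟S_ {G = G})
  module MR = Monomials K (_≟R_ {G = G})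
  module MS = Monomials K (_≟S_ {G = G})
  open PRG using (Mon; exp; deg; _≈ₘ_; _∣ₘ_; binom)
  open PRG.Toric (wtR {G = G}) using (tvec)
  module KerR = MR.ToricKernel (wtR {G = G})

  rS-injective : PSG.InjectiveRank rS
  rS-injective = proj₁ goodS

  rR-injective : PRG.InjectiveRank rR
  rR-injective = proj₁ goodR

  _≺_ : Mon → Mon → Set
  _≺_ = PRG.revlex rR

  module OrdR = MR.Revlex rR rR-injective
  module LeadR = MR.Leading rR rR-injective
  module LeadS = MS.Leading rS rS-injective

  zS<xS : ∀ i → rS zS < rS (xS i)
  zS<xS = proj₁ (proj₂ goodS)

  xS<yS : ∀ i j k p e → rS (xS i) < rS (yS j k p e)
  xS<yS = proj₂ (proj₂ goodS)

  z<x : ∀ i α → rR z < rR (x i α)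
  z<x = proj₁ (proj₂ goodR)

  x<y : ∀ i α j k p e β γ → rR (x i α) < rR (y j k p e β γ)
  x<y = proj₁ (proj₂ (proj₂ goodR))

  φ-mono-x : ∀ ε i j → rS (xS i) < rS (xS j) → rR (φ ε (xS i)) < rR (φ ε (xS j))
  φ-mono-x = proj₁ (proj₂ (proj₂ (proj₂ goodR)))

  φ-mono-y : ∀ ε i j p e k l q e' → rS (yS i j p e) < rS (yS k l q e') → rR (φ ε (yS i j p e)) < rR (φ ε (yS k l q e'))
  φ-mono-y = proj₂ (proj₂ (proj₂ (proj₂ goodR)))

  z-minimal : ∀ u → ¬ (rR u < rR z)
  z-minimal z r = ℕP.<-irrefl refl r
  z-minimal (x i α) r = ℕP.<-asym r (z<x i α)
  z-minimal (y i j p e α β) r = ℕP.<-asym r (ℕP.<-trans (z<x i α) (x<y i α i j p e α β))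

  x<yv : ∀ k γ i j e α β → rR (x k γ) < rR (yv i j e α β)
  x<yv k γ i j e α β = below (yv-shape i j e α β)
    where
      below : ∀ {v} → YShape i j α β v → rR (x k γ) < rR v
      below (inj₁ (p , e' , refl)) = x<y k γ _ _ p e' _ _
      below (inj₂ (p , e' , refl)) = x<y k γ _ _ p e' _ _

  φ-mono : ∀ ε a b → rS a < rS b → rR (φ ε a) < rR (φ ε b)
  φ-mono ε zS zS r = ⊥-elim (ℕP.<-irrefl refl r)
  φ-mono ε zS (xS i) r = z<x i (ε i)
  φ-mono ε zS (yS j k p e) r = ℕP.<-trans (z<x j (ε j)) (x<y j (ε j) j k p e (ε j) (ε k))
  φ-mono ε (xS i) zS r = ⊥-elim (ℕP.<-asym r (zS<xS i))
  φ-mono ε (xS i) (xS j) r = φ-mono-x ε i j r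
  φ-mono ε (xS i) (yS j k p e) r = x<y i (ε i) j k p e (ε j) (ε k)
  φ-mono ε (yS i j p e) zS r = ⊥-elim (ℕP.<-asym r (ℕP.<-trans (zS<xS i) (xS<yS i i j p e)))
  φ-mono ε (yS i j p e) (xS k) r = ⊥-elim (ℕP.<-asym r (xS<yS k i j p e))
  φ-mono ε (yS i j p e) (yS k l q e') r = φ-mono-y ε i j p e k l q e' r

  module Rename (ε : Fin d → Sgn) = Renaming K _≟S_ _≟R_ (φ ε) unsign (unsign∘φ ε)
  module RenameOrd (ε : Fin d → Sgn) = Rename.Orders ε rS rR rS-injective rR-injective (φ-mono ε)

  signAt : RVar G → Fin d → Maybe Sgn
  signAt z i = nothing
  signAt (x j α) i = if ⌊ j FinP.≟ i ⌋ then just α else nothing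
  signAt (y a b p e α β) i = if ⌊ a FinP.≟ i ⌋ then just α else (if ⌊ b FinP.≟ i ⌋ then just β else nothing)

  ≟-self : ∀ (i : Fin d) → ⌊ i FinP.≟ i ⌋ ≡ true
  ≟-self i with i FinP.≟ i
  ... | yes _ = refl
  ... | no i≢i = ⊥-elim (i≢i refl)

  sign-x : ∀ i α → signAt (x i α) i ≡ just α
  sign-x i α rewrite ≟-self i = refl

  sign-yv : ∀ i j e α β → signAt (yv i j e α β) i ≡ just α
  sign-yv i j e α β = sign (yv-shape i j e α β)
    where
      sign : ∀ {v} → YShape i j α β v → signAt v i ≡ just α
      sign (inj₁ (p , _ , refl)) rewrite ≟-self i = refl
      sign (inj₂ (p , _ , refl)) rewrite ≟-self i with j FinP.≟ i
      ... | yes refl = ⊥-elim (ℕP.<-irrefl refl p)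
      ... | no _ = refl

  sign-≢ : ∀ {u₁ u₂ i s₁ s₂} → signAt u₁ i ≡ just s₁ → signAt u₂ i ≡ just s₂ → s₁ ≢ s₂ → u₁ ≢ u₂
  sign-≢ e₁ e₂ s₁≢s₂ refl = s₁≢s₂ (just-injective (trans (sym e₁) e₂))

  SignedAt : Fin d → Sgn → RVar G → Set
  SignedAt i s v = (v ≡ x i s) ⊎ (Σ[ j ∈ Fin d ] Σ[ e ∈ T (adj G i j) ] Σ[ τ ∈ Sgn ] (v ≡ yv i j e s τ))

  signedAt : ∀ v i s → signAt v i ≡ just s → SignedAt i s v
  signedAt z i s ()
  signedAt (x j α) i s eq with j FinP.≟ i
  signedAt (x j α) i s refl | yes refl = inj₁ refl
  signedAt (x j α) i s () | no _
  signedAt (y a b p e α β) i s eq with a FinP.≟ i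
  signedAt (y a b p e α β) i s refl | yes refl = inj₂ (b , e , β , sym (yv-< a b p e α β))
  ... | no _ with b FinP.≟ i
  signedAt (y a b p e α β) i s refl | no _ | yes refl =
    inj₂ (a , subst T (adj-sym G a b) e , α ,
          trans (y-irrelevant a b p p e _ α β) (sym (yv-> b a p (subst T (adj-sym G a b) e) β α)))
  signedAt (y a b p e α β) i s () | no _ | no _

  -- The binomials of the last three families of 𝒢′, as rewriting rules
  -- lead → trail  (lead is the initial monomial)

  data Rule : Mon → Mon → Set where
    xy-rule : ∀ i j e α β γ → α ≢ β → Rule (x i α ∷ yv i j e β γ ∷ []) (x j γ ∷ z ∷ [])
    yy-rule : ∀ i j k eij eik α β γ δ → α ≢ β → Rule (yv i j eij α γ ∷ yv i k eik β δ ∷ []) (x j γ ∷ x k δ ∷ [])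
    xx-rule : ∀ i → Rule (x i ⊕ ∷ x i ⊖ ∷ []) (z ∷ z ∷ [])

  rule∈G′ : ∀ {l t} 𝒢 → Rule l t → G′ K G 𝒢 (binom l t)
  rule∈G′ 𝒢 (xy-rule i j e α β γ α≢β) = inj₂ (inj₁ (i , j , e , α , β , γ , α≢β , refl))
  rule∈G′ 𝒢 (yy-rule i j k eij eik α β γ δ α≢β) = inj₂ (inj₂ (inj₁ (i , j , k , eij , eik , α , β , γ , δ , α≢β , refl)))
  rule∈G′ 𝒢 (xx-rule i) = inj₂ (inj₂ (inj₂ (i , refl)))

  G′-view : ∀ 𝒢 {g} → G′ K G 𝒢 g →
    (Σ[ ε ∈ (Fin d → Sgn) ] Σ[ h ∈ PSG.Poly ] (h ∈ 𝒢 × g ≡ PSG.mapPoly (φ ε) h)) ⊎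
    (Σ[ l ∈ Mon ] Σ[ t ∈ Mon ] (Rule l t × g ≡ binom l t))
  G′-view 𝒢 (inj₁ image) = inj₁ image
  G′-view 𝒢 (inj₂ (inj₁ (i , j , e , α , β , γ , α≢β , refl))) = inj₂ (_ , _ , xy-rule i j e α β γ α≢β , refl)
  G′-view 𝒢 (inj₂ (inj₂ (inj₁ (i , j , k , eij , eik , α , β , γ , δ , α≢β , refl)))) =
    inj₂ (_ , _ , yy-rule i j k eij eik α β γ δ α≢β , refl)
  G′-view 𝒢 (inj₂ (inj₂ (inj₂ (i , refl)))) = inj₂ (_ , _ , xx-rule i , refl)

  -- trail ≺ lead: for the xy- and xx-rules the trailing monomial contains z,
  -- for the yy-rule it contains an x-variable below both y-variables
  rule-≺ : ∀ {l t} → Rule l t → t ≺ l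
  rule-≺ (xy-rule i j e α β γ _) =
    OrdR.≺-by-minimal (x j γ ∷ z ∷ []) (x i α ∷ yv i j e β γ ∷ []) z z-minimal refl z-excess
    where
      z-excess : exp (x i α ∷ yv i j e β γ ∷ []) z < exp (x j γ ∷ z ∷ []) z
      z-excess rewrite MR.exp-pair≡0 (x i α) (yv i j e β γ) z (λ ()) (yv≢z i j e β γ) = s≤s z≤n
  rule-≺ (yy-rule i j k eij eik α β γ δ _) with rR (x j γ) ℕ.≤? rR (x k δ)
  ... | yes xj≤xk = OrdR.pair-≺ (x j γ) (x k δ) _ _ xj≤xk (x<yv j γ i j eij α γ) (x<yv j γ i k eik β δ)
  ... | no xj≰xk = OrdR.≺-resp {x k δ ∷ x j γ ∷ []} {x j γ ∷ x k δ ∷ []} {Y} {Y}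
        (MR.↭⇒≈ₘ {x k δ ∷ x j γ ∷ []} {x j γ ∷ x k δ ∷ []} (swap (x k δ) (x j γ) Perm.refl)) (MR.≈ₘ-refl {Y})
        (OrdR.pair-≺ (x k δ) (x j γ) _ _ (ℕP.<⇒≤ (ℕP.≰⇒> xj≰xk)) (x<yv k δ i j eij α γ) (x<yv k δ i k eik β δ))
    where Y = yv i j eij α γ ∷ yv i k eik β δ ∷ []
  rule-≺ (xx-rule i) = OrdR.≺-by-minimal (z ∷ z ∷ []) (x i ⊕ ∷ x i ⊖ ∷ []) z z-minimal refl (s≤s z≤n)

  rule-leading : ∀ {l t} → Rule l t → PRG.IsLeading _≺_ (binom l t) l
  rule-leading {l} {t} r = LeadR.binom-leading l t (rule-≺ r)

  rule-deg : ∀ {l t} → Rule l t → deg l ≡ deg t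
  rule-deg (xy-rule _ _ _ _ _ _ _) = refl
  rule-deg (yy-rule _ _ _ _ _ _ _ _ _ _) = refl
  rule-deg (xx-rule _) = refl

  rule-quadratic : ∀ {l t} → Rule l t → PRG.Quadratic l
  rule-quadratic (xy-rule _ _ _ _ _ _ _) = refl
  rule-quadratic (yy-rule _ _ _ _ _ _ _ _ _ _) = refl
  rule-quadratic (xx-rule _) = refl

  pair-squarefree : ∀ a b → a ≢ b → PRG.Squarefree (a ∷ b ∷ [])
  pair-squarefree a b a≢b v with a ≟R v | b ≟R v
  ... | yes refl | yes refl = ⊥-elim (a≢b refl)
  ... | yes _ | no _ = s≤s z≤n
  ... | no _ | yes _ = s≤s z≤n
  ... | no _ | no _ = z≤n

  rule-squarefree : ∀ {l t} → Rule l t → PRG.Squarefree l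
  rule-squarefree (xy-rule i j e α β γ _) = pair-squarefree (x i α) (yv i j e β γ) (λ q → yv≢x i j e β γ i α (sym q))
  rule-squarefree (yy-rule i j k eij eik α β γ δ α≢β) =
    pair-squarefree (yv i j eij α γ) (yv i k eik β δ) (sign-≢ (sign-yv i j eij α γ) (sign-yv i k eik β δ) α≢β)
  rule-squarefree (xx-rule i) = pair-squarefree (x i ⊕) (x i ⊖) (λ ())

  private
    regroup-xy : ∀ A B C → A ℤ.+ ((B ℤ.+ C) ℤ.+ 0ℤ) ≡ (A ℤ.+ B) ℤ.+ (C ℤ.+ (0ℤ ℤ.+ 0ℤ))
    regroup-xy = solve-∀
    regroup-yy : ∀ A B C D → (A ℤ.+ C) ℤ.+ ((B ℤ.+ D) ℤ.+ 0ℤ) ≡ (A ℤ.+ B) ℤ.+ (C ℤ.+ (D ℤ.+ 0ℤ))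
    regroup-yy = solve-∀
    regroup-xx : ∀ A B → A ℤ.+ (B ℤ.+ 0ℤ) ≡ (A ℤ.+ B) ℤ.+ (0ℤ ℤ.+ (0ℤ ℤ.+ 0ℤ))
    regroup-xx = solve-∀
    cancel-left : ∀ A B C → A ℤ.+ B ≡ 0ℤ → (A ℤ.+ B) ℤ.+ C ≡ C
    cancel-left A B C A+B≡0 = trans (cong (ℤ._+ C) A+B≡0) (ℤP.+-identityˡ C)

  unitv-cancel : ∀ i α β k → α ≢ β → unitv {G = G} i α k ℤ.+ unitv {G = G} i β k ≡ 0ℤ
  unitv-cancel i α β k α≢β with k FinP.≟ i
  unitv-cancel i ⊕ ⊕ k α≢β | yes _ = ⊥-elim (α≢β refl)
  unitv-cancel i ⊕ ⊖ k α≢β | yes _ = refl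
  unitv-cancel i ⊖ ⊕ k α≢β | yes _ = refl
  unitv-cancel i ⊖ ⊖ k α≢β | yes _ = ⊥-elim (α≢β refl)
  ... | no _ = refl

  wt-yv : ∀ i j e α β k → wtR (yv i j e α β) k ≡ unitv {G = G} i α k ℤ.+ unitv {G = G} j β k
  wt-yv i j e α β k = wt (yv-shape i j e α β)
    where
      wt : ∀ {v} → YShape i j α β v → wtR v k ≡ unitv {G = G} i α k ℤ.+ unitv {G = G} j β k
      wt (inj₁ (_ , _ , refl)) = refl
      wt (inj₂ (_ , _ , refl)) = ℤP.+-comm (unitv {G = G} j β k) (unitv {G = G} i α k)

  rule-tvec : ∀ {l t} → Rule l t → ∀ k → tvec l k ≡ tvec t k
  rule-tvec (xy-rule i j e α β γ α≢β) k rewrite wt-yv i j e β γ k =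
    trans (regroup-xy (u i α) (u i β) (u j γ)) (cancel-left (u i α) (u i β) _ (unitv-cancel i α β k α≢β))
    where u = λ i' α' → unitv {G = G} i' α' k
  rule-tvec (yy-rule i j k eij eik α β γ δ α≢β) k' rewrite wt-yv i j eij α γ k' | wt-yv i k eik β δ k' =
    trans (regroup-yy (u i α) (u i β) (u j γ) (u k δ)) (cancel-left (u i α) (u i β) _ (unitv-cancel i α β k' α≢β))
    where u = λ i' α' → unitv {G = G} i' α' k'
  rule-tvec (xx-rule i) k =
    trans (regroup-xx (u i ⊕) (u i ⊖)) (cancel-left (u i ⊕) (u i ⊖) _ (unitv-cancel i ⊕ ⊖ k (λ ())))
    where u = λ i' α' → unitv {G = G} i' α' k

  rule∈ker : ∀ {l t} → Rule l t → I-B K G (binom l t)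
  rule∈ker {l} {t} r = KerR.binom-ker l t (rule-tvec r) (rule-deg r)

  -- A monomial w is δ-consistent if it lies in the image
  -- of φ_δ, i.e. every index occurs in w with the sign prescribed by δ.

  Consistent : (Fin d → Sgn) → Mon → Set
  Consistent δ w = All (Rename.InImage δ) w

  Reducible : Mon → Set
  Reducible w = Σ[ l ∈ Mon ] Σ[ t ∈ Mon ] (Rule l t × l ∣ₘ w)

  clash⇒reducible : ∀ w {v₁ v₂ i s₁ s₂} → v₁ ∈ w → v₂ ∈ w →
    signAt v₁ i ≡ just s₁ → signAt v₂ i ≡ just s₂ → s₁ ≢ s₂ → Reducible w
  clash⇒reducible w {v₁} {v₂} {i} {s₁} {s₂} v₁∈ v₂∈ e₁ e₂ s₁≢s₂ with signedAt v₁ i s₁ e₁ | signedAt v₂ i s₂ e₂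
  ... | inj₁ refl | inj₁ refl with s₁ | s₂
  ...   | ⊕ | ⊖ = _ , _ , xx-rule i , MR.pair∣ₘ (λ ()) v₁∈ v₂∈
  ...   | ⊖ | ⊕ = _ , _ , xx-rule i , MR.pair∣ₘ (λ ()) v₂∈ v₁∈
  ...   | ⊕ | ⊕ = ⊥-elim (s₁≢s₂ refl)
  ...   | ⊖ | ⊖ = ⊥-elim (s₁≢s₂ refl)
  clash⇒reducible w {i = i} {s₁} {s₂} v₁∈ v₂∈ e₁ e₂ s₁≢s₂ | inj₁ refl | inj₂ (j , e , τ , refl) =
    _ , _ , xy-rule i j e s₁ s₂ τ s₁≢s₂ , MR.pair∣ₘ (sign-≢ (sign-x i s₁) (sign-yv i j e s₂ τ) s₁≢s₂) v₁∈ v₂∈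
  clash⇒reducible w {i = i} {s₁} {s₂} v₁∈ v₂∈ e₁ e₂ s₁≢s₂ | inj₂ (j , e , τ , refl) | inj₁ refl =
    _ , _ , xy-rule i j e s₂ s₁ τ (s₁≢s₂ ∘ sym) ,
    MR.pair∣ₘ (sign-≢ (sign-x i s₂) (sign-yv i j e s₁ τ) (s₁≢s₂ ∘ sym)) v₂∈ v₁∈
  clash⇒reducible w {i = i} {s₁} {s₂} v₁∈ v₂∈ e₁ e₂ s₁≢s₂ | inj₂ (j , ej , τ , refl) | inj₂ (k , ek , τ₂ , refl) =
    _ , _ , yy-rule i j k ej ek s₁ s₂ τ τ₂ s₁≢s₂ ,
    MR.pair∣ₘ (sign-≢ (sign-yv i j ej s₁ τ) (sign-yv i k ek s₂ τ₂) s₁≢s₂) v₁∈ v₂∈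

  firstSign : Mon → Fin d → Sgn
  firstSign [] i = ⊕
  firstSign (v ∷ w) i with signAt v i
  ... | just s = s
  ... | nothing = firstSign w i

  firstSign-attained : ∀ w {v i s} → v ∈ w → signAt v i ≡ just s →
    Σ[ v₀ ∈ RVar G ] (v₀ ∈ w × signAt v₀ i ≡ just (firstSign w i))
  firstSign-attained (u ∷ w) {i = i} v∈ sv with signAt u i in eq
  ... | just _ = u , here refl , eq
  firstSign-attained (u ∷ w) (here refl) sv | nothing = case trans (sym eq) sv of λ ()
  firstSign-attained (u ∷ w) (there v∈) sv | nothing with firstSign-attained w v∈ sv
  ... | v₀ , v₀∈ , e₀ = v₀ , there v₀∈ , e₀

  outside⇒wrongSign : ∀ δ v → ¬ Rename.InImage δ v → Σ[ i ∈ Fin d ] Σ[ s ∈ Sgn ] (signAt v i ≡ just s × s ≢ δ i)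
  outside⇒wrongSign δ z v∉ = ⊥-elim (v∉ refl)
  outside⇒wrongSign δ (x j α) v∉ with α ≟s δ j
  ... | yes refl = ⊥-elim (v∉ refl)
  ... | no α≢ = j , α , sign-x j α , α≢
  outside⇒wrongSign δ (y a b p e α β) v∉ with α ≟s δ a
  ... | no α≢ = a , α , subst (λ v → signAt v a ≡ just α) (yv-< a b p e α β) (sign-yv a b e α β) , α≢
  ... | yes refl with β ≟s δ b
  ... | yes refl = ⊥-elim (v∉ refl)
  ... | no β≢ = b , β , sign-at-b , β≢
    where
      sign-at-b : signAt (y a b p e (δ a) β) b ≡ just β
      sign-at-b rewrite ≟-self b with a FinP.≟ b
      ... | yes refl = ⊥-elim (ℕP.<-irrefl refl p)
      ... | no _ = refl

  consistent-or-reducible : ∀ w → (Σ[ δ ∈ (Fin d → Sgn) ] Consistent δ w) ⊎ Reducible w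
  consistent-or-reducible w with Rename.all-inImage? (firstSign w) w
  ... | yes consistent = inj₁ (firstSign w , consistent)
  ... | no not-all with Rename.not-all-inImage (firstSign w) w not-all
  ... | v , v∈ , v∉ with outside⇒wrongSign (firstSign w) v v∉
  ... | i , s , sv , s≢ with firstSign-attained w v∈ sv
  ... | v₀ , v₀∈ , sv₀ = inj₂ (clash⇒reducible w v∈ v₀∈ sv sv₀ s≢)

  -- Rewriting with the rules keeps
  -- the π-image, goes down in ≺ and lowers the weight (z:0, x:1, y:2), so
  -- every monomial reduces to a consistent one with the same π-image.

  SameImage : Mon → Mon → Set
  SameImage a b = (∀ i → tvec a i ≡ tvec b i) × deg a ≡ deg b

  SameImage-trans : ∀ {a b c'} → SameImage a b → SameImage b c' → SameImage a c'
  SameImage-trans (t₁ , d₁) (t₂ , d₂) = (λ i → trans (t₁ i) (t₂ i)) , trans d₁ d₂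

  SameImage-≈ₘ : ∀ a b → a ≈ₘ b → SameImage a b
  SameImage-≈ₘ a b e = KerR.tvec-≈ₘ a b e , MR.deg-≈ₘ {a} {b} e

  weightV : RVar G → ℕ
  weightV z = 0
  weightV (x _ _) = 1
  weightV (y _ _ _ _ _ _) = 2

  open MR.Additive ℕP.+-0-commutativeMonoid using () renaming (total to totalℕ; total-++ to totalℕ-++; total-≈ₘ to totalℕ-≈ₘ)

  weight : Mon → ℕ
  weight = totalℕ weightV

  weight-yv : ∀ i j e α β → weightV (yv i j e α β) ≡ 2
  weight-yv i j e α β = weight-y (yv i j e α β) (yv-isY i j e α β)
    where
      weight-y : ∀ v → IsY v → weightV v ≡ 2
      weight-y (y _ _ _ _ _ _) _ = refl

  rule-weight : ∀ {l t} → Rule l t → weight l ≡ 2 ℕ.+ weight t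
  rule-weight (xy-rule i j e α β γ _) rewrite weight-yv i j e β γ = refl
  rule-weight (yy-rule i j k eij eik α β γ δ _) rewrite weight-yv i j eij α γ | weight-yv i k eik β δ = refl
  rule-weight (xx-rule i) = refl

  rewrite-step : ∀ {l t} w → Rule l t → l ∣ₘ w →
    Σ[ w′ ∈ Mon ] (SameImage w′ w × w′ ≺ w × suc (weight w′) < weight w)
  rewrite-step {l} {t} w r l∣w with MR.quotient l w l∣w
  ... | rest , w≈lr = t ++ rest , same , ≺w , lighter
    where
      tr≈ : SameImage (t ++ rest) (l ++ rest)
      tr≈ = (λ i → trans (KerR.tvec-++ t rest i)
                   (trans (cong (ℤ._+ tvec rest i) (sym (rule-tvec r i))) (sym (KerR.tvec-++ l rest i)))) ,
            trans (ListP.length-++ t) (trans (cong (ℕ._+ length rest) (sym (rule-deg r))) (sym (ListP.length-++ l)))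
      same : SameImage (t ++ rest) w
      same = SameImage-trans {t ++ rest} {l ++ rest} {w} tr≈ (SameImage-≈ₘ (l ++ rest) w (MR.≈ₘ-sym {w} {l ++ rest} w≈lr))
      ≺w : (t ++ rest) ≺ w
      ≺w = OrdR.≺-resp {t ++ rest} {t ++ rest} {l ++ rest} {w} (MR.≈ₘ-refl {t ++ rest}) (MR.≈ₘ-sym {w} {l ++ rest} w≈lr)
             (OrdR.≺-*ʳ {t} {l} rest (rule-≺ r))
      lighter : suc (weight (t ++ rest)) < weight w
      lighter = ℕP.≤-reflexive (sym (begin
        weight w                          ≡⟨ totalℕ-≈ₘ weightV w (l ++ rest) w≈lr ⟩
        weight (l ++ rest)                ≡⟨ totalℕ-++ weightV l rest ⟩
        weight l ℕ.+ weight rest          ≡⟨ cong (ℕ._+ weight rest) (rule-weight r) ⟩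
        2 ℕ.+ (weight t ℕ.+ weight rest)  ≡⟨ cong (2 ℕ.+_) (sym (totalℕ-++ weightV t rest)) ⟩
        2 ℕ.+ weight (t ++ rest)          ∎))
        where open ≡.≡-Reasoning

  ConsistentForm : Mon → Set
  ConsistentForm w =
    Σ[ n ∈ Mon ] ((Σ[ δ ∈ (Fin d → Sgn) ] Consistent δ n) × SameImage n w × ((n ≈ₘ w) ⊎ (n ≺ w)))

  consistentForm : ∀ k w → weight w < k → ConsistentForm w
  consistentForm (suc k) w bound with consistent-or-reducible w
  ... | inj₁ consistent = w , consistent , ((λ i → refl) , refl) , inj₁ (MR.≈ₘ-refl {w})
  ... | inj₂ (l , t , r , l∣w) with rewrite-step w r l∣w
  ... | w′ , same′ , w′≺w , lighter
    with consistentForm k w′ (ℕP.≤-trans (ℕP.n≤1+n _) (ℕP.≤-trans lighter (ℕP.≤-pred bound)))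
  ... | n , consistent , same , n≼w′ =
    n , consistent , SameImage-trans {n} {w′} {w} same same′ , inj₂ (OrdR.≼-≺-trans {n} {w′} {w} n≼w′ w′≺w)

  consistentForm-of : ∀ w → ConsistentForm w
  consistentForm-of w = consistentForm (suc (weight w)) w ℕP.≤-refl

  -- If the index i occurs n times in w ∈ S_G,
  -- then t_i occurs in π(φ_δ w) with exponent δ_i·n.  Hence π(φ_ε w) and
  -- π(ι w) determine each other, and the signs of π(φ_δ w) recover δ on
  -- the indices occurring in w.

  sg : Sgn → ℤ
  sg = sgnℤ {G = G}

  sg-involutive : ∀ s C → sg s ℤ.* (sg s ℤ.* C) ≡ C
  sg-involutive s C = trans (sym (ℤP.*-assoc (sg s) (sg s) C)) (trans (cong (ℤ._* C) (sg² s)) (ℤP.*-identityˡ C))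
    where
      sg² : ∀ s → sg s ℤ.* sg s ≡ ℤ.1ℤ
      sg² ⊕ = refl
      sg² ⊖ = refl

  signOf : ℤ → Sgn
  signOf (ℤ.+ _) = ⊕
  signOf ℤ.-[1+ _ ] = ⊖

  signOf-sg : ∀ s n → signOf (sg s ℤ.* ℤ.+ (suc n)) ≡ s
  signOf-sg ⊕ n = refl
  signOf-sg ⊖ n = refl

  occurrences : Fin d → SVar G → ℕ
  occurrences i zS = 0
  occurrences i (xS j) = if ⌊ i FinP.≟ j ⌋ then 1 else 0
  occurrences i (yS a b p e) = (if ⌊ i FinP.≟ a ⌋ then 1 else 0) ℕ.+ (if ⌊ i FinP.≟ b ⌋ then 1 else 0)

  occurrencesM : Fin d → PSG.Mon → ℕ
  occurrencesM i [] = 0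
  occurrencesM i (v ∷ w) = occurrences i v ℕ.+ occurrencesM i w

  wt-φ : ∀ δ v i → wtR (φ δ v) i ≡ sg (δ i) ℤ.* ℤ.+ (occurrences i v)
  wt-φ δ zS i = sym (ℤP.*-zeroʳ (sg (δ i)))
  wt-φ δ (xS j) i with i FinP.≟ j
  ... | yes refl = sym (ℤP.*-identityʳ (sg (δ i)))
  ... | no _ = sym (ℤP.*-zeroʳ (sg (δ i)))
  wt-φ δ (yS a b p e) i with i FinP.≟ a | i FinP.≟ b
  ... | yes refl | yes refl = ⊥-elim (ℕP.<-irrefl refl p)
  ... | yes refl | no _ = trans (ℤP.+-identityʳ _) (sym (ℤP.*-identityʳ (sg (δ i))))
  ... | no _ | yes refl = trans (ℤP.+-identityˡ _) (sym (ℤP.*-identityʳ (sg (δ i))))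
  ... | no _ | no _ = sym (ℤP.*-zeroʳ (sg (δ i)))

  tvec-φ : ∀ δ w i → tvec (map (φ δ) w) i ≡ sg (δ i) ℤ.* ℤ.+ (occurrencesM i w)
  tvec-φ δ [] i = sym (ℤP.*-zeroʳ (sg (δ i)))
  tvec-φ δ (v ∷ w) i = begin
    wtR (φ δ v) i ℤ.+ tvec (map (φ δ) w) i                                ≡⟨ cong₂ ℤ._+_ (wt-φ δ v i) (tvec-φ δ w i) ⟩
    sg (δ i) ℤ.* ℤ.+ occurrences i v ℤ.+ sg (δ i) ℤ.* ℤ.+ occurrencesM i w ≡⟨ sym (ℤP.*-distribˡ-+ (sg (δ i)) _ _) ⟩
    sg (δ i) ℤ.* (ℤ.+ occurrences i v ℤ.+ ℤ.+ occurrencesM i w)            ≡⟨ cong (sg (δ i) ℤ.*_) (sym (ℤP.pos-+ (occurrences i v) (occurrencesM i w))) ⟩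
    sg (δ i) ℤ.* ℤ.+ (occurrences i v ℕ.+ occurrencesM i w)               ∎
    where open ≡.≡-Reasoning

  tvec-ι : ∀ ε w i → tvec (map ι w) i ≡ sg (ε i) ℤ.* tvec (map (φ ε) w) i
  tvec-ι ε w i = begin
    tvec (map ι w) i                                    ≡⟨ tvec-φ (λ _ → ⊕) w i ⟩
    ℤ.1ℤ ℤ.* ℤ.+ occurrencesM i w                        ≡⟨ ℤP.*-identityˡ _ ⟩
    ℤ.+ occurrencesM i w                                 ≡⟨ sym (sg-involutive (ε i) _) ⟩
    sg (ε i) ℤ.* (sg (ε i) ℤ.* ℤ.+ occurrencesM i w)     ≡⟨ cong (sg (ε i) ℤ.*_) (sym (tvec-φ ε w i)) ⟩
    sg (ε i) ℤ.* tvec (map (φ ε) w) i                    ∎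
    where open ≡.≡-Reasoning

  φ-local : ∀ δ ε v → (∀ i → 1 ≤ occurrences i v → δ i ≡ ε i) → φ δ v ≡ φ ε v
  φ-local δ ε zS agree = refl
  φ-local δ ε (xS j) agree = cong (x j) (agree j j-occurs)
    where
      j-occurs : 1 ≤ occurrences j (xS j)
      j-occurs rewrite ≟-self j = s≤s z≤n
  φ-local δ ε (yS a b p e) agree = cong₂ (y a b p e) (agree a a-occurs) (agree b b-occurs)
    where
      a-occurs : 1 ≤ occurrences a (yS a b p e)
      a-occurs rewrite ≟-self a = s≤s z≤n
      b-occurs : 1 ≤ occurrences b (yS a b p e)
      b-occurs rewrite ≟-self b = ℕP.m≤n+m 1 _

  occurrencesM-∈ : ∀ {v w} i → v ∈ w → 1 ≤ occurrences i v → 1 ≤ occurrencesM i w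
  occurrencesM-∈ {v} {_ ∷ w} i (here refl) occ = ℕP.≤-trans occ (ℕP.m≤m+n (occurrences i v) (occurrencesM i w))
  occurrencesM-∈ {v} {u ∷ w} i (there v∈) occ = ℕP.≤-trans (occurrencesM-∈ i v∈ occ) (ℕP.m≤n+m _ (occurrences i u))

  resign : ∀ δ ε w → (∀ i → ε i ≡ signOf (tvec (map (φ δ) w) i)) → map (φ δ) w ≡ map (φ ε) w
  resign δ ε w ε-signs =
    ListP.map-cong-local (All.tabulate λ v∈ → φ-local δ ε _ λ i occ → agree i (occurrencesM-∈ i v∈ occ))
    where
      agree : ∀ i → 1 ≤ occurrencesM i w → δ i ≡ ε i
      agree i occ with occurrencesM i w | tvec-φ δ w i
      ... | suc n | tvec≡ = sym (trans (ε-signs i) (trans (cong signOf tvec≡) (signOf-sg (δ i) n)))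

  -- φ_ε maps I_{P_G̃} into I_{B_G}: the fibre of π∘φ_ε over t^u s^k is the
  -- fibre of π∘ι over t^{ε·u} s^k
  φ-ker : ∀ ε h → I-P K G h → I-B K G (PSG.mapPoly (φ ε) h)
  φ-ker ε h h∈ker u k = ≈-trans (≈-reflexive sums≡) (h∈ker u′ k)
    where
      open Field K using () renaming (trans to ≈-trans; reflexive to ≈-reflexive)
      u′ : Fin d → ℤ
      u′ i = sg (ε i) ℤ.* u i
      flip : ∀ m i → ⌊ tvec (map (φ ε) m) i ℤ.≟ u i ⌋ ≡ ⌊ tvec (map ι m) i ℤ.≟ u′ i ⌋
      flip m i = trans (isYes≗does (_ ℤ.≟ _)) (trans (does-⇔ flip⇔ (_ ℤ.≟ _) (_ ℤ.≟ _)) (sym (isYes≗does (_ ℤ.≟ _))))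
        where
          flip⇔ : (tvec (map (φ ε) m) i ≡ u i) ⇔ (tvec (map ι m) i ≡ u′ i)
          flip⇔ = mk⇔ (λ eq → trans (tvec-ι ε m i) (cong (sg (ε i) ℤ.*_) eq))
                      (λ eq → trans (sym (sg-involutive (ε i) _))
                                (trans (cong (sg (ε i) ℤ.*_) (trans (sym (tvec-ι ε m i)) eq)) (sg-involutive (ε i) (u i))))
      fibres≡ : ∀ m → KerR.InFibre u k (map (φ ε) m) ≡ KerR.InFibre u′ k (map ι m)
      fibres≡ m = cong₂ _∧_ (allFin-cong _ _ (flip m))
                            (cong (_≡ᵇ k) (trans (ListP.length-map (φ ε) m) (sym (ListP.length-map ι m))))
      sums≡ : PRG.sumWhere (KerR.InFibre u k) (PSG.mapPoly (φ ε) h) ≡ PRG.sumWhere (KerR.InFibre u′ k) (PSG.mapPoly ι h)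
      sums≡ = trans (Rename.sumWhere-map ε _ h)
                (trans (MS.sumWhere-cong _ _ h fibres≡) (sym (Rename.sumWhere-map (λ _ → ⊕) _ h)))

  -- Two consistent monomials n ≺ m with the same
  -- π-image are φ_ε-images for one and the same ε (the signs of π(m)), and
  -- their preimages form a binomial of I_{P_G̃} with leading monomial the
  -- preimage of m.

  PulledBack : Mon → Mon → Set ℓ
  PulledBack m n =
    Σ[ ε ∈ (Fin d → Sgn) ] (m ≡ map (φ ε) (map unsign m) ×
      I-P K G (PSG.binom (map unsign m) (map unsign n)) ×
      PSG.IsLeading (PSG.revlex rS) (PSG.binom (map unsign m) (map unsign n)) (map unsign m))

  pullback : ∀ m n {δ δ′} → Consistent δ m → Consistent δ′ n → SameImage n m → n ≺ m → PulledBack m n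
  pullback m n {δ} {δ′} m-cons n-cons (tvec≡ , deg≡) n≺m = ε , m≡ , binom∈ker , binom-leading
    where
      m′ = map unsign m
      n′ = map unsign n
      ε : Fin d → Sgn
      ε i = signOf (tvec m i)
      m≡ : m ≡ map (φ ε) m′
      m≡ = trans (Rename.all-inImage⇒ δ m m-cons)
                 (resign δ ε m′ λ i → cong (λ w → signOf (tvec w i)) (Rename.all-inImage⇒ δ m m-cons))
      n≡ : n ≡ map (φ ε) n′
      n≡ = trans (Rename.all-inImage⇒ δ′ n n-cons)
                 (resign δ′ ε n′ λ i → cong signOf (trans (sym (tvec≡ i)) (cong (λ w → tvec w i) (Rename.all-inImage⇒ δ′ n n-cons))))
      ι-tvec≡ : ∀ i → tvec (map ι m′) i ≡ tvec (map ι n′) i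
      ι-tvec≡ i = begin
        tvec (map ι m′) i                   ≡⟨ tvec-ι ε m′ i ⟩
        sg (ε i) ℤ.* tvec (map (φ ε) m′) i   ≡⟨ cong (λ w → sg (ε i) ℤ.* tvec w i) (sym m≡) ⟩
        sg (ε i) ℤ.* tvec m i               ≡⟨ cong (sg (ε i) ℤ.*_) (sym (tvec≡ i)) ⟩
        sg (ε i) ℤ.* tvec n i               ≡⟨ cong (λ w → sg (ε i) ℤ.* tvec w i) n≡ ⟩
        sg (ε i) ℤ.* tvec (map (φ ε) n′) i   ≡⟨ sym (tvec-ι ε n′ i) ⟩
        tvec (map ι n′) i                   ∎
        where open ≡.≡-Reasoning
      ι-deg≡ : deg (map ι m′) ≡ deg (map ι n′)
      ι-deg≡ = trans (ListP.length-map ι m′) (trans (ListP.length-map unsign m)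
                 (trans (sym deg≡) (trans (sym (ListP.length-map unsign n)) (sym (ListP.length-map ι n′)))))
      binom∈ker : I-P K G (PSG.binom m′ n′)
      binom∈ker = KerR.binom-ker (map ι m′) (map ι n′) ι-tvec≡ ι-deg≡
      binom-leading : PSG.IsLeading (PSG.revlex rS) (PSG.binom m′ n′) m′
      binom-leading = LeadS.binom-leading m′ n′ (RenameOrd.≺-reflect ε n′ m′ (subst₂ _≺_ n≡ m≡ n≺m))

  module GroebnerBasis (𝒢 : List PSG.Poly) (𝒢-gb : PSG.IsGroebner (PSG.revlex rS) (I-P K G) (_∈ 𝒢)) where

    G′⊆ker : ∀ g → G′ K G 𝒢 g → I-B K G g
    G′⊆ker g g∈G′ with G′-view 𝒢 g∈G′
    ... | inj₁ (ε , h , h∈𝒢 , refl) = φ-ker ε h (proj₁ 𝒢-gb h h∈𝒢)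
    ... | inj₂ (l , t , r , refl) = rule∈ker r

    DivisibleByG′ : Mon → Set (c Level.⊔ ℓ)
    DivisibleByG′ m = Σ[ g ∈ PRG.Poly ] Σ[ m′ ∈ Mon ] (G′ K G 𝒢 g × PRG.IsLeading _≺_ g m′ × m′ ∣ₘ m)

    -- the φ_ε-image of the element of 𝒢 dividing the pulled-back binomial
    pulledBack-divisible : ∀ m n → PulledBack m n → DivisibleByG′ m
    pulledBack-divisible m n (ε , m≡ , binom∈ker , binom-leading)
      with proj₂ 𝒢-gb (PSG.binom (map unsign m) (map unsign n)) (map unsign m) binom∈ker binom-leading
    ... | h , mh , h∈𝒢 , h-leading , mh∣m′ =
      PSG.mapPoly (φ ε) h , map (φ ε) mh , inj₁ (ε , h , h∈𝒢 , refl) , RenameOrd.leading-map ε h mh h-leading ,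
      subst (map (φ ε) mh ∣ₘ_) (sym m≡) (Rename.∣ₘ-map ε mh (map unsign m) mh∣m′)

    -- The leading monomial m of f ∈ I_{B_G} is either divisible by the lead
    -- of a rule, or consistent; then f has a term w ≺ m with the same
    -- π-image, w reduces to a consistent n ≼ w, and m, n pull back to S_G.
    leading-divisible : ∀ f m → I-B K G f → PRG.IsLeading _≺_ f m → DivisibleByG′ m
    leading-divisible f m f∈ker m-leading with consistent-or-reducible m
    ... | inj₂ (l , t , r , l∣m) = binom l t , l , rule∈G′ 𝒢 r , rule-leading r , l∣m
    ... | inj₁ (δ , m-cons) with KerR.kernel-partner rR rR-injective f m f∈ker m-leading
    ... | w , w-tvec≡ , w-deg≡ , w≺m with consistentForm-of w
    ... | n , (δ′ , n-cons) , n-same , n≼w =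
      pulledBack-divisible m n
        (pullback m n m-cons n-cons (SameImage-trans {n} {w} {m} n-same (w-tvec≡ , w-deg≡))
                  (OrdR.≼-≺-trans {n} {w} {m} n≼w w≺m))

    G′-groebner : PRG.IsGroebner _≺_ (I-B K G) (G′ K G 𝒢)
    G′-groebner = G′⊆ker , leading-divisible

    -- Generators of initial ideals.  in_<(I_{B_G}) is generated by the
    -- φ_ε-images of generators of in_<(I_{P_G̃}) together with the leads of
    -- the rules; so any property of generators preserved by the φ_ε and
    -- shared by the rule leads passes from in(I_{P_G̃}) to in(I_{B_G}).

    initial-transfer : (QS : PSG.Mon → Set) (QR : Mon → Set) →
      (∀ ε s → QS s → QR (map (φ ε) s)) → (∀ {l t} → Rule l t → QR l) →
      PSG.InitialGeneratedBy QS (PSG.revlex rS) (I-P K G) →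
      PRG.InitialGeneratedBy QR _≺_ (I-B K G)
    initial-transfer QS QR QS⇒QR rule-QR (gensS , gensS-ok , gensS-generate) = gensR , gensR-ok , gensR-generate
      where
        gensR : Mon → Set
        gensR m = (Σ[ ε ∈ (Fin d → Sgn) ] Σ[ s ∈ PSG.Mon ] (gensS s × m ≡ map (φ ε) s)) ⊎
                  (Σ[ l ∈ Mon ] Σ[ t ∈ Mon ] (Rule l t × m ≡ l))

        gensR-ok : ∀ s → gensR s → QR s × PRG.InInitial _≺_ (I-B K G) s
        gensR-ok _ (inj₁ (ε , s , s-gen , refl)) with gensS-ok s s-gen
        ... | QS-s , (f , m₀ , f∈ker , m₀-leading , m₀∣s) =
          QS⇒QR ε s QS-s ,
          (PSG.mapPoly (φ ε) f , map (φ ε) m₀ , φ-ker ε f f∈ker ,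
           RenameOrd.leading-map ε f m₀ m₀-leading , Rename.∣ₘ-map ε m₀ s m₀∣s)
        gensR-ok _ (inj₂ (l , t , r , refl)) = rule-QR r , (binom l t , l , rule∈ker r , rule-leading r , MR.∣ₘ-refl {l})

        G′-lead-generated : ∀ g m₁ → G′ K G 𝒢 g → PRG.IsLeading _≺_ g m₁ → Σ[ s ∈ Mon ] (gensR s × s ∣ₘ m₁)
        G′-lead-generated g m₁ g∈G′ m₁-leading with G′-view 𝒢 g∈G′
        ... | inj₂ (l , t , r , refl) =
          l , inj₂ (l , t , r , refl) ,
          MR.∣ₘ-respˡ {m₁} {l} {m₁} (LeadR.leading-unique (binom l t) m₁ l m₁-leading (rule-leading r)) (MR.∣ₘ-refl {m₁})
        ... | inj₁ (ε , h , h∈𝒢 , refl) with RenameOrd.leading-reflect ε h m₁ m₁-leading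
        ... | m₁′ , refl , m₁′-leading
          with gensS-generate m₁′ (h , m₁′ , proj₁ 𝒢-gb h h∈𝒢 , m₁′-leading , MS.∣ₘ-refl {m₁′})
        ... | s , s-gen , s∣m₁′ = map (φ ε) s , inj₁ (ε , s , s-gen , refl) , Rename.∣ₘ-map ε s m₁′ s∣m₁′

        gensR-generate : ∀ m → PRG.InInitial _≺_ (I-B K G) m → Σ[ s ∈ Mon ] (gensR s × s ∣ₘ m)
        gensR-generate m (f , m₀ , f∈ker , m₀-leading , m₀∣m) with leading-divisible f m₀ f∈ker m₀-leading
        ... | g , m₁ , g∈G′ , m₁-leading , m₁∣m₀ with G′-lead-generated g m₁ g∈G′ m₁-leading
        ... | s , s-gen , s∣m₁ = s , s-gen , MR.∣ₘ-trans {s} {m₀} {m} (MR.∣ₘ-trans {s} {m₁} {m₀} s∣m₁ m₁∣m₀) m₀∣m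

  squarefree-map : ∀ ε s → PSG.Squarefree s → PRG.Squarefree (map (φ ε) s)
  squarefree-map ε s sqfree v with Rename.inImage? ε v
  ... | yes v∈ rewrite v∈ | Rename.exp-φ ε s (unsign v) = sqfree (unsign v)
  ... | no v∉ rewrite Rename.exp-outside ε s v v∉ = z≤n

  quadratic-map : ∀ ε s → PSG.Quadratic s → PRG.Quadratic (map (φ ε) s)
  quadratic-map ε s quad = trans (ListP.length-map (φ ε) s) quad

lemma2p3 : ∀ {c ℓ} (K : Field c ℓ) (d : ℕ) (G : Graph d)
    (rS : SVar G → ℕ) (rR : RVar G → ℕ) (𝒢 : List (PS.Poly K G)) →
    GoodRankS G rS →
    GoodRankR G rS rR →
    PS.IsGroebner K G (PS.revlex K G rS) (I-P K G) (λ h → h ∈ 𝒢) →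
    PR.IsGroebner K G (PR.revlex K G rR) (I-B K G) (G′ K G 𝒢)
    × (∀ i j e α β γ → α ≢ β →
         PR.IsLeading K G (PR.revlex K G rR)
           (PR.binom K G (x i α ∷ yv i j e β γ ∷ []) (x j γ ∷ z ∷ []))
           (x i α ∷ yv i j e β γ ∷ []))
    × (∀ i j k eij eik α β γ δ → α ≢ β →
         PR.IsLeading K G (PR.revlex K G rR)
           (PR.binom K G (yv i j eij α γ ∷ yv i k eik β δ ∷ []) (x j γ ∷ x k δ ∷ []))
           (yv i j eij α γ ∷ yv i k eik β δ ∷ []))
    × (∀ (i : Fin d) →
         PR.IsLeading K G (PR.revlex K G rR)
           (PR.binom K G (x i ⊕ ∷ x i ⊖ ∷ []) (z ∷ z ∷ []))
           (x i ⊕ ∷ x i ⊖ ∷ []))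
    × (PS.InitialGeneratedBy K G (PS.Squarefree K G) (PS.revlex K G rS) (I-P K G) →
         PR.InitialGeneratedBy K G (PR.Squarefree K G) (PR.revlex K G rR) (I-B K G))
    × (PS.InitialGeneratedBy K G (PS.Quadratic K G) (PS.revlex K G rS) (I-P K G) →
         PR.InitialGeneratedBy K G (PR.Quadratic K G) (PR.revlex K G rR) (I-B K G))
lemma2p3 K d G rS rR 𝒢 goodS goodR 𝒢-gb =
  G′-groebner ,
  (λ i j e α β γ α≢β → rule-leading (xy-rule i j e α β γ α≢β)) ,
  (λ i j k eij eik α β γ δ α≢β → rule-leading (yy-rule i j k eij eik α β γ δ α≢β)) ,
  (λ i → rule-leading (xx-rule i)) ,
  initial-transfer _ _ squarefree-map rule-squarefree ,
  initial-transfer _ _ quadratic-map rule-quadratic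
  where
    open Setting K G rS rR goodS goodR
    open GroebnerBasis 𝒢 𝒢-gb
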